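{- Let $G$ be an arbitrary directed graph on vertex set $U=U_0\cup U_1$ (disjoint union) and $H$ a directed graph on vertex set $V=V_0\cup V_1$ (disjoint union), with partitioned adjacency matrices $G=\begin{pmatrix}G_{00}&G_{01}\\ G_{10}&G_{11}\end{pmatrix}$ and $H=\begin{pmatrix}H_{00}&H_{01}\\ H_{10}&H_{11}\end{pmatrix}$. Let $l=\min(|U_0|,|U_1|)$. Suppose $G_{01}=QSR^{ -1}$ and $G_{10}=RTQ^{ -1}$, where $Q$ is a nonsingular $|U_0|\times|U_0|$ complex matrix, $R$ is a nonsingular $|U_1|\times|U_1|$ complex matrix, $S$ is $|U_0|\times|U_1|$, $T$ is $|U_1|\times|U_0|$, $S_{ij}=T_{ij}=0$ for $i>j$, and for each $1\le j\le l$ either $S_{jj}=T_{jj}$ or $S_{jj}T_{jj}=0$. Let $(\sigma_1,\ldots,\sigma_l)$ be such that, for each $j$, either $\sigma_j=S_{jj}=T_{jj}$ or $\sigma_j=0=S_{jj}T_{jj}$. Then $$p(G\,\underline{\times}\,H)=\begin{cases}\left(\prod_{j=1}^l p(H\uparrow\sigma_j)\right)p(H_{00})^{|U_0|-|U_1|}, & \text{if } |U_0|\ge |U_1|;\\[4pt] \left(\prod_{j=1}^l p(H\uparrow\sigma_j)\right)p(H_{11})^{|U_1|-|U_0|}, & \text{if } |U_1|\ge |U_0|.\end{cases}$$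
   Context: Graphs are identified with their adjacency matrices (nonnegative integer entries; multiple arcs allowed). $G_{ij}$ is the $|U_i|\times|U_j|$ submatrix of arcs of $G$ from $U_i$ to $U_j$; $H_{ij}$ is the $|V_i|\times|V_j|$ submatrix of arcs of $H$ from $V_i$ to $V_j$. The partitioned tensor product is the matrix $$G\,\underline{\times}\,H=\begin{pmatrix} I_{|U_0|}\otimes H_{00} & G_{01}\otimes H_{01}\\ G_{10}\otimes H_{10} & I_{|U_1|}\otimes H_{11}\end{pmatrix},$$ where $\otimes$ is the Kronecker product and $I_k$ the $k\times k$ identity. For a complex number $\sigma$, $H\uparrow\sigma=\begin{pmatrix}H_{00}&\sigma H_{01}\\ \sigma H_{10}&H_{11}\end{pmatrix}$. For a square matrix $M$, $p(M)=\det(\lambda I-M)$ is its characteristic polynomial (with $p$ of a $0\times0$ matrix equal to $1$). (Such a decomposition of $G_{01},G_{10}$ always exists.) -}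

module Defs where

open import Level using (Level; _⊔_)
open import Algebra.Bundles using (CommutativeRing)
open import Data.Nat as ℕ using (ℕ; zero; suc; _⊓_; _<_)
open import Data.Nat.Properties using (m⊓n≤m; m⊓n≤n; <-≤-trans)
open import Data.Fin using (Fin; zero; suc; toℕ; fromℕ<; punchIn; splitAt; quotient; remainder; _≟_)
open import Data.Fin.Properties using (toℕ<n)
open import Data.List using (List; []; _∷_; map)
open import Data.Sum using (_⊎_; inj₁; inj₂)
open import Data.Product using (_×_; ∃)
open import Data.Bool using (if_then_else_)
open import Relation.Nullary using (¬_)
open import Relation.Nullary.Decidable using (⌊_⌋)

Mat : ∀ {a} → Set a → ℕ → ℕ → Set a
Mat A m n = Fin m → Fin n → A

module DetOps {a} {A : Set a} (_+_ _*_ : A → A → A) (neg : A → A) (0a 1a : A) where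
  altSum : ∀ n → (Fin (suc n) → A) → A
  altSum zero    f = f zero
  altSum (suc n) f = f zero + neg (altSum n (λ j → f (suc j)))

  det : ∀ n → Mat A n n → A
  det zero    M = 1a
  det (suc n) M = altSum n (λ j → M zero j * det n (λ i k → M (suc i) (punchIn j k)))

module Over {c ℓ} (R : CommutativeRing c ℓ) where
  open CommutativeRing R public using (Carrier; _≈_; _+_; _*_; -_; 0#; 1#)

  -- field axioms (R plays the role of ℂ)
  IsFieldCR : Set (c ⊔ ℓ)
  IsFieldCR = (¬ (1# ≈ 0#)) × (∀ x → ¬ (x ≈ 0#) → ∃ λ y → (x * y) ≈ 1#)

  fromℕ : ℕ → Carrier
  fromℕ zero    = 0#
  fromℕ (suc n) = 1# + fromℕ n

  -- polynomials over R: coefficient lists, lowest degree first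
  Poly : Set c
  Poly = List Carrier

  _+P_ : Poly → Poly → Poly
  []      +P q       = q
  (x ∷ p) +P []      = x ∷ p
  (x ∷ p) +P (y ∷ q) = (x + y) ∷ (p +P q)

  scaleP : Carrier → Poly → Poly
  scaleP x = map (x *_)

  _*P_ : Poly → Poly → Poly
  []      *P q = []
  (x ∷ p) *P q = scaleP x q +P (0# ∷ (p *P q))

  negP : Poly → Poly
  negP = map (-_)

  constP : Carrier → Poly
  constP x = x ∷ []

  0P 1P Xλ : Poly
  0P = []
  1P = 1# ∷ []
  Xλ = 0# ∷ 1# ∷ []

  _^P_ : Poly → ℕ → Poly
  p ^P zero  = 1P
  p ^P suc k = p *P (p ^P k)

  prodP : ∀ n → (Fin n → Poly) → Poly
  prodP zero    f = 1P
  prodP (suc n) f = f zero *P prodP n (λ j → f (suc j))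

  -- equality of polynomials: equal coefficients (missing ones are 0)
  data _≈P_ : Poly → Poly → Set (c ⊔ ℓ) where
    nil  : [] ≈P []
    nilˡ : ∀ {y q} → 0# ≈ y → [] ≈P q → [] ≈P (y ∷ q)
    nilʳ : ∀ {x p} → x ≈ 0# → p ≈P [] → (x ∷ p) ≈P []
    cons : ∀ {x y p q} → x ≈ y → p ≈P q → (x ∷ p) ≈P (y ∷ q)

  det : ∀ n → Mat Carrier n n → Carrier
  det = DetOps.det _+_ _*_ -_ 0# 1#

  detP : ∀ n → Mat Poly n n → Poly
  detP = DetOps.det _+P_ _*P_ negP 0P 1P

  charPoly : ∀ {n} → Mat Carrier n n → Poly
  charPoly {n} M = detP n (λ i j → (if ⌊ i ≟ j ⌋ then Xλ else 0P) +P negP (constP (M i j)))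

  toR : ∀ {m n} → Mat ℕ m n → Mat Carrier m n
  toR A i j = fromℕ (A i j)

  Id : ∀ n → Mat Carrier n n
  Id n i j = if ⌊ i ≟ j ⌋ then 1# else 0#

  sumF : ∀ n → (Fin n → Carrier) → Carrier
  sumF zero    f = 0#
  sumF (suc n) f = f zero + sumF n (λ j → f (suc j))

  _⊛_ : ∀ {m n p} → Mat Carrier m n → Mat Carrier n p → Mat Carrier m p
  _⊛_ {n = n} A B i k = sumF n (λ j → A i j * B j k)

  _≈M_ : ∀ {m n} → Mat Carrier m n → Mat Carrier m n → Set ℓ
  A ≈M B = ∀ i j → A i j ≈ B i j

  scaleM : ∀ {m n} → Carrier → Mat Carrier m n → Mat Carrier m n
  scaleM s A i j = s * A i j

  -- Kronecker product; index of Fin (m * p) is (row of A, row of B), A-major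
  kron : ∀ {m n p q} → Mat Carrier m n → Mat Carrier p q → Mat Carrier (m ℕ.* p) (n ℕ.* q)
  kron {m} {n} {p} {q} A B i j =
    A (quotient {m} p i) (quotient {n} q j) * B (remainder {m} p i) (remainder {n} q j)

  block : ∀ {m₀ m₁ n₀ n₁} → Mat Carrier m₀ n₀ → Mat Carrier m₀ n₁ →
          Mat Carrier m₁ n₀ → Mat Carrier m₁ n₁ → Mat Carrier (m₀ ℕ.+ m₁) (n₀ ℕ.+ n₁)
  block {m₀} {m₁} {n₀} {n₁} A B C D i j with splitAt m₀ i | splitAt n₀ j
  ... | inj₁ a | inj₁ b = A a b
  ... | inj₁ a | inj₂ b = B a b
  ... | inj₂ a | inj₁ b = C a b
  ... | inj₂ a | inj₂ b = D a b

  -- partitioned tensor product G ×̲ H (only G₀₁, G₁₀ and the blocks of H enter)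
  ptp : ∀ {u₀ u₁ v₀ v₁} → Mat ℕ u₀ u₁ → Mat ℕ u₁ u₀ →
        Mat ℕ v₀ v₀ → Mat ℕ v₀ v₁ → Mat ℕ v₁ v₀ → Mat ℕ v₁ v₁ →
        Mat Carrier (u₀ ℕ.* v₀ ℕ.+ u₁ ℕ.* v₁) (u₀ ℕ.* v₀ ℕ.+ u₁ ℕ.* v₁)
  ptp {u₀} {u₁} G₀₁ G₁₀ H₀₀ H₀₁ H₁₀ H₁₁ =
    block (kron (Id u₀) (toR H₀₀)) (kron (toR G₀₁) (toR H₀₁))
          (kron (toR G₁₀) (toR H₁₀)) (kron (Id u₁) (toR H₁₁))

  _↑_ : ∀ {v₀ v₁} → (Mat ℕ v₀ v₀ × Mat ℕ v₀ v₁ × Mat ℕ v₁ v₀ × Mat ℕ v₁ v₁) →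
        Carrier → Mat Carrier (v₀ ℕ.+ v₁) (v₀ ℕ.+ v₁)
  (H₀₀ Data.Product., H₀₁ Data.Product., H₁₀ Data.Product., H₁₁) ↑ σ =
    block (toR H₀₀) (scaleM σ (toR H₀₁)) (scaleM σ (toR H₁₀)) (toR H₁₁)

  UpperTri : ∀ {m n} → Mat Carrier m n → Set ℓ
  UpperTri A = ∀ i j → toℕ j < toℕ i → A i j ≈ 0#

  diagEntry : ∀ {m n} → Mat Carrier m n → Fin (m ⊓ n) → Carrier
  diagEntry {m} {n} A j =
    A (fromℕ< (<-≤-trans (toℕ<n j) (m⊓n≤m m n)))
      (fromℕ< (<-≤-trans (toℕ<n j) (m⊓n≤n m n)))

  -- same, indexed by Fin (n ⊓ m) (used for T : |U₁|×|U₀| with l = min(|U₀|,|U₁|))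
  diagEntry′ : ∀ {m n} → Mat Carrier m n → Fin (n ⊓ m) → Carrier
  diagEntry′ {m} {n} A j =
    A (fromℕ< (<-≤-trans (toℕ<n j) (m⊓n≤n n m)))
      (fromℕ< (<-≤-trans (toℕ<n j) (m⊓n≤m n m)))

-- Conjugation by diag(Q⁻¹ ⊗ I, R⁻¹ ⊗ I) turns G ×̲ H into the same product with G₀₁ and G₁₀
-- replaced by S and T, without changing the characteristic polynomial. As S and T are upper
-- triangular, the vertices {u} × V₀ and {u′} × V₁ of the first vertices u ∈ U₀ and u′ ∈ U₁ span an
-- invariant subspace, on which the matrix acts as H with off-diagonal blocks scaled by S₁₁ and
-- T₁₁. Peeling these off one by one leaves I ⊗ H₀₀ or I ⊗ H₁₁ once one side is exhausted.
-- Finally, the characteristic polynomial of H with off-diagonal blocks scaled by s and t depends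
-- only on s t, which is what the choice of σⱼ controls. Everything holds over any commutative
-- ring: determinants are Laplace expansions, and their multiplicativity comes from expanding
-- multilinearly in the columns and sorting column maps by adjacent transpositions.

module Submission where

open import Defs
open import Algebra.Bundles using (CommutativeRing)
open import Data.Nat using (ℕ; _⊓_; _∸_; _≤_)
open import Data.Fin using (Fin)
open import Data.Product using (_×_; _,_)
open import Data.Sum using (_⊎_)

open import Level using (_⊔_)
open import Function using (_∘_; const)
open import Data.Nat using (zero; suc)
import Data.Nat as ℕ
import Data.Nat.Properties as ℕ
open import Data.Fin using (zero; suc; inject₁; punchIn; punchOut; toℕ; fromℕ<; _↑ˡ_; _↑ʳ_; splitAt; quotient; remainder; combine)
import Data.Fin as Fin
open import Data.Fin.Properties
  using (suc-injective; punchInᵢ≢i; punchIn-punchOut; punchOut-punchIn; punchOut-cong; punchOut-injective;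
         toℕ-injective; toℕ-inject₁; toℕ<n; toℕ-fromℕ<; toℕ-↑ˡ; toℕ-↑ʳ; ↑ˡ-injective; ↑ʳ-injective;
         splitAt-↑ˡ; splitAt-↑ʳ; splitAt⁻¹-↑ˡ; splitAt⁻¹-↑ʳ; remQuot-combine; combine-remQuot; any?; pigeonhole)
open import Data.Product using (proj₁; proj₂)
open import Data.Sum using (inj₁; inj₂; [_,_]′)
import Data.Sum as Sum
open import Data.Bool using (true; false; if_then_else_)
open import Data.Empty using (⊥-elim)
open import Relation.Nullary using (yes; no)
open import Relation.Nullary.Decidable using (⌊_⌋)
open import Relation.Binary.PropositionalEquality as ≡ using (_≡_; _≢_)
open import Relation.Binary.Structures using (IsEquivalence)
open import Relation.Binary.Bundles using (Setoid)
import Relation.Binary.Reasoning.Setoid as ≈-Reasoning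
import Data.Vec.Functional.Relation.Binary.Equality.Setoid as VectorSetoid
open import Algebra.Morphism.Structures using (IsRingHomomorphism)
import Algebra.Properties.Ring as RingProperties
open import Algebra.Properties.CommutativeSemigroup ℕ.+-commutativeSemigroup using () renaming (interchange to +-interchange)
import Algebra.Solver.Ring.NaturalCoefficients.Default as NaturalCoefficientsSolver

module Polynomial {c ℓ} (R : CommutativeRing c ℓ) where
  open import Data.List using ([]; _∷_)
  open Over R
  open CommutativeRing R hiding (Carrier; _≈_; _+_; _*_; -_; 0#; 1#; zero)
  open RingProperties ring using (-0#≈0#; -‿+-comm; -‿distribʳ-*)
  open NaturalCoefficientsSolver commutativeSemiring using (solve; _:+_; _:*_; _:=_)

  coeff : Poly → ℕ → Carrier
  coeff []      n       = 0#
  coeff (x ∷ p) zero    = x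
  coeff (x ∷ p) (suc n) = coeff p n

  coeff-cong : ∀ {p q} → p ≈P q → ∀ n → coeff p n ≈ coeff q n
  coeff-cong nil        n       = refl
  coeff-cong (nilˡ e r) zero    = e
  coeff-cong (nilˡ e r) (suc n) = coeff-cong r n
  coeff-cong (nilʳ e r) zero    = e
  coeff-cong (nilʳ e r) (suc n) = coeff-cong r n
  coeff-cong (cons e r) zero    = e
  coeff-cong (cons e r) (suc n) = coeff-cong r n

  ≈P-ext : ∀ {p q} → (∀ n → coeff p n ≈ coeff q n) → p ≈P q
  ≈P-ext {[]}    {[]}    h = nil
  ≈P-ext {[]}    {y ∷ q} h = nilˡ (h zero) (≈P-ext λ n → h (suc n))
  ≈P-ext {x ∷ p} {[]}    h = nilʳ (h zero) (≈P-ext λ n → h (suc n))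
  ≈P-ext {x ∷ p} {y ∷ q} h = cons (h zero) (≈P-ext λ n → h (suc n))

  ≈P-refl : ∀ {p} → p ≈P p
  ≈P-refl = ≈P-ext λ n → refl

  ≈P-sym : ∀ {p q} → p ≈P q → q ≈P p
  ≈P-sym e = ≈P-ext λ n → sym (coeff-cong e n)

  ≈P-trans : ∀ {p q r} → p ≈P q → q ≈P r → p ≈P r
  ≈P-trans e f = ≈P-ext λ n → trans (coeff-cong e n) (coeff-cong f n)

  ≈P-isEquivalence : IsEquivalence _≈P_
  ≈P-isEquivalence = record { refl = ≈P-refl ; sym = ≈P-sym ; trans = ≈P-trans }

  coeff-+P : ∀ p q n → coeff (p +P q) n ≈ coeff p n + coeff q n
  coeff-+P []      q       n       = sym (+-identityˡ _)
  coeff-+P (x ∷ p) []      n       = sym (+-identityʳ _)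
  coeff-+P (x ∷ p) (y ∷ q) zero    = refl
  coeff-+P (x ∷ p) (y ∷ q) (suc n) = coeff-+P p q n

  coeff-negP : ∀ p n → coeff (negP p) n ≈ - coeff p n
  coeff-negP []      n       = sym -0#≈0#
  coeff-negP (x ∷ p) zero    = refl
  coeff-negP (x ∷ p) (suc n) = coeff-negP p n

  coeff-scaleP : ∀ a p n → coeff (scaleP a p) n ≈ a * coeff p n
  coeff-scaleP a []      n       = sym (zeroʳ a)
  coeff-scaleP a (x ∷ p) zero    = refl
  coeff-scaleP a (x ∷ p) (suc n) = coeff-scaleP a p n

  +P-cong : ∀ {p p′ q q′} → p ≈P p′ → q ≈P q′ → (p +P q) ≈P (p′ +P q′)
  +P-cong {p} {p′} {q} {q′} e f = ≈P-ext λ n →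
    trans (coeff-+P p q n) (trans (+-cong (coeff-cong e n) (coeff-cong f n)) (sym (coeff-+P p′ q′ n)))

  negP-cong : ∀ {p q} → p ≈P q → negP p ≈P negP q
  negP-cong {p} {q} e = ≈P-ext λ n →
    trans (coeff-negP p n) (trans (-‿cong (coeff-cong e n)) (sym (coeff-negP q n)))

  scaleP-cong : ∀ {a b p q} → a ≈ b → p ≈P q → scaleP a p ≈P scaleP b q
  scaleP-cong {a} {b} {p} {q} e f = ≈P-ext λ n →
    trans (coeff-scaleP a p n) (trans (*-cong e (coeff-cong f n)) (sym (coeff-scaleP b q n)))

  +P-assoc : ∀ p q r → ((p +P q) +P r) ≈P (p +P (q +P r))
  +P-assoc p q r = ≈P-ext λ n → begin
    coeff ((p +P q) +P r) n                ≈⟨ coeff-+P (p +P q) r n ⟩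
    coeff (p +P q) n + coeff r n           ≈⟨ +-congʳ (coeff-+P p q n) ⟩
    (coeff p n + coeff q n) + coeff r n    ≈⟨ +-assoc _ _ _ ⟩
    coeff p n + (coeff q n + coeff r n)    ≈⟨ +-congˡ (coeff-+P q r n) ⟨
    coeff p n + coeff (q +P r) n           ≈⟨ coeff-+P p (q +P r) n ⟨
    coeff (p +P (q +P r)) n                ∎
    where open ≈-Reasoning setoid

  +P-comm : ∀ p q → (p +P q) ≈P (q +P p)
  +P-comm p q = ≈P-ext λ n → trans (coeff-+P p q n) (trans (+-comm _ _) (sym (coeff-+P q p n)))

  +P-identityʳ : ∀ p → (p +P []) ≈P p
  +P-identityʳ p = ≈P-ext λ n → trans (coeff-+P p [] n) (+-identityʳ _)

  negP-inverseʳ : ∀ p → (p +P negP p) ≈P []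
  negP-inverseʳ p = ≈P-ext λ n →
    trans (coeff-+P p (negP p) n) (trans (+-congˡ (coeff-negP p n)) (-‿inverseʳ _))

  negP-inverseˡ : ∀ p → (negP p +P p) ≈P []
  negP-inverseˡ p = ≈P-trans (+P-comm (negP p) p) (negP-inverseʳ p)

  +P-interchange : ∀ p q r s → ((p +P q) +P (r +P s)) ≈P ((p +P r) +P (q +P s))
  +P-interchange p q r s = ≈P-ext λ n →
    trans (coeff-+P (p +P q) (r +P s) n) (trans (+-cong (coeff-+P p q n) (coeff-+P r s n))
      (trans (interchange _ _ _ _)
        (sym (trans (coeff-+P (p +P r) (q +P s) n) (+-cong (coeff-+P p r n) (coeff-+P q s n))))))
    where
    interchange : ∀ a b c d → (a + b) + (c + d) ≈ (a + c) + (b + d)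
    interchange = solve 4 (λ a b c d → ((a :+ b) :+ (c :+ d)) := ((a :+ c) :+ (b :+ d))) refl

  +P-leftComm : ∀ p q r → (p +P (q +P r)) ≈P (q +P (p +P r))
  +P-leftComm p q r = ≈P-trans (≈P-sym (+P-assoc p q r))
    (≈P-trans (+P-cong (+P-comm p q) ≈P-refl) (+P-assoc q p r))

  scaleP-distribˡ : ∀ a p q → scaleP a (p +P q) ≈P (scaleP a p +P scaleP a q)
  scaleP-distribˡ a p q = ≈P-ext λ n →
    trans (coeff-scaleP a (p +P q) n) (trans (*-congˡ (coeff-+P p q n)) (trans (distribˡ a _ _)
      (sym (trans (coeff-+P (scaleP a p) (scaleP a q) n) (+-cong (coeff-scaleP a p n) (coeff-scaleP a q n))))))

  scaleP-distribʳ : ∀ a b p → scaleP (a + b) p ≈P (scaleP a p +P scaleP b p)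
  scaleP-distribʳ a b p = ≈P-ext λ n →
    trans (coeff-scaleP (a + b) p n) (trans (distribʳ _ a b)
      (sym (trans (coeff-+P (scaleP a p) (scaleP b p) n) (+-cong (coeff-scaleP a p n) (coeff-scaleP b p n)))))

  scaleP-assoc : ∀ a b p → scaleP a (scaleP b p) ≈P scaleP (a * b) p
  scaleP-assoc a b p = ≈P-ext λ n →
    trans (coeff-scaleP a (scaleP b p) n) (trans (*-congˡ (coeff-scaleP b p n))
      (trans (sym (*-assoc a b _)) (sym (coeff-scaleP (a * b) p n))))

  scaleP-zeroˡ : ∀ {a} p → a ≈ 0# → scaleP a p ≈P []
  scaleP-zeroˡ {a} p e = ≈P-ext λ n → trans (coeff-scaleP a p n) (trans (*-congʳ e) (zeroˡ _))

  scaleP-identityˡ : ∀ p → scaleP 1# p ≈P p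
  scaleP-identityˡ p = ≈P-ext λ n → trans (coeff-scaleP 1# p n) (*-identityˡ _)

  0∷[]≈P[] : (0# ∷ []) ≈P []
  0∷[]≈P[] = nilʳ refl nil

  0∷-+P : ∀ p q → (0# ∷ (p +P q)) ≈P ((0# ∷ p) +P (0# ∷ q))
  0∷-+P p q = cons (sym (+-identityˡ 0#)) ≈P-refl

  0∷-*P : ∀ p q → ((0# ∷ p) *P q) ≈P (0# ∷ (p *P q))
  0∷-*P p q = +P-cong (scaleP-zeroˡ q refl) ≈P-refl

  *P-congˡ : ∀ p {q q′} → q ≈P q′ → (p *P q) ≈P (p *P q′)
  *P-congˡ []      e = nil
  *P-congˡ (x ∷ p) e = +P-cong (scaleP-cong refl e) (cons refl (*P-congˡ p e))

  *P-zeroˡ : ∀ {p} q → p ≈P [] → (p *P q) ≈P []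
  *P-zeroˡ q nil        = nil
  *P-zeroˡ q (nilʳ e r) = ≈P-trans (+P-cong (scaleP-zeroˡ q e) (cons refl (*P-zeroˡ q r))) 0∷[]≈P[]

  *P-congʳ : ∀ {p p′} q → p ≈P p′ → (p *P q) ≈P (p′ *P q)
  *P-congʳ q nil          = nil
  *P-congʳ q (nilˡ e r)   = ≈P-sym (*P-zeroˡ q (≈P-sym (nilˡ e r)))
  *P-congʳ q (nilʳ e r)   = *P-zeroˡ q (nilʳ e r)
  *P-congʳ q (cons e r)   = +P-cong (scaleP-cong e ≈P-refl) (cons refl (*P-congʳ q r))

  *P-cong : ∀ {p p′ q q′} → p ≈P p′ → q ≈P q′ → (p *P q) ≈P (p′ *P q′)
  *P-cong {p′ = p′} {q} e f = ≈P-trans (*P-congʳ q e) (*P-congˡ p′ f)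

  *P-distribʳ : ∀ r p q → ((p +P q) *P r) ≈P ((p *P r) +P (q *P r))
  *P-distribʳ r []      q       = ≈P-refl
  *P-distribʳ r (x ∷ p) []      = ≈P-sym (+P-identityʳ _)
  *P-distribʳ r (x ∷ p) (y ∷ q) =
    ≈P-trans (+P-cong (scaleP-distribʳ x y r) (≈P-trans (cons refl (*P-distribʳ r p q)) (0∷-+P (p *P r) (q *P r))))
             (+P-interchange (scaleP x r) (scaleP y r) (0# ∷ (p *P r)) (0# ∷ (q *P r)))

  *P-distribˡ : ∀ r p q → (r *P (p +P q)) ≈P ((r *P p) +P (r *P q))
  *P-distribˡ []      p q = nil
  *P-distribˡ (x ∷ r) p q =
    ≈P-trans (+P-cong (scaleP-distribˡ x p q) (≈P-trans (cons refl (*P-distribˡ r p q)) (0∷-+P (r *P p) (r *P q))))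
             (+P-interchange (scaleP x p) (scaleP x q) (0# ∷ (r *P p)) (0# ∷ (r *P q)))

  *P-zeroʳ : ∀ p → (p *P []) ≈P []
  *P-zeroʳ []      = nil
  *P-zeroʳ (x ∷ p) = nilʳ refl (*P-zeroʳ p)

  *P-∷ʳ : ∀ p y q → (p *P (y ∷ q)) ≈P (scaleP y p +P (0# ∷ (p *P q)))
  *P-∷ʳ []      y q = ≈P-sym 0∷[]≈P[]
  *P-∷ʳ (x ∷ p) y q = cons (+-congʳ (*-comm x y))
    (≈P-trans (+P-cong ≈P-refl (*P-∷ʳ p y q)) (+P-leftComm (scaleP x q) (scaleP y p) (0# ∷ (p *P q))))

  *P-comm : ∀ p q → (p *P q) ≈P (q *P p)
  *P-comm []      q = ≈P-sym (*P-zeroʳ q)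
  *P-comm (x ∷ p) q = ≈P-trans (+P-cong ≈P-refl (cons refl (*P-comm p q))) (≈P-sym (*P-∷ʳ q x p))

  scaleP-*P : ∀ a p q → (scaleP a p *P q) ≈P scaleP a (p *P q)
  scaleP-*P a []      q = nil
  scaleP-*P a (y ∷ p) q =
    ≈P-trans (+P-cong (≈P-sym (scaleP-assoc a y q)) (≈P-trans (cons refl (scaleP-*P a p q)) (cons (sym (zeroʳ a)) ≈P-refl)))
             (≈P-sym (scaleP-distribˡ a (scaleP y q) (0# ∷ (p *P q))))

  *P-assoc : ∀ p q r → ((p *P q) *P r) ≈P (p *P (q *P r))
  *P-assoc []      q r = nil
  *P-assoc (x ∷ p) q r =
    ≈P-trans (*P-distribʳ r (scaleP x q) (0# ∷ (p *P q)))
      (+P-cong (scaleP-*P x q r) (≈P-trans (0∷-*P (p *P q) r) (cons refl (*P-assoc p q r))))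

  *P-identityˡ : ∀ p → (1P *P p) ≈P p
  *P-identityˡ p = ≈P-trans (+P-cong (scaleP-identityˡ p) 0∷[]≈P[]) (+P-identityʳ p)

  polyCommutativeRing : CommutativeRing c (c ⊔ ℓ)
  polyCommutativeRing = record
    { Carrier = Poly ; _≈_ = _≈P_ ; _+_ = _+P_ ; _*_ = _*P_ ; -_ = negP ; 0# = 0P ; 1# = 1P
    ; isCommutativeRing = record
      { isRing = record
        { +-isAbelianGroup = record
          { isGroup = record
            { isMonoid = record
              { isSemigroup = record
                { isMagma = record { isEquivalence = ≈P-isEquivalence ; ∙-cong = +P-cong }
                ; assoc = +P-assoc }
              ; identity = (λ p → ≈P-refl) , +P-identityʳ }
            ; inverse = negP-inverseˡ , negP-inverseʳ
            ; ⁻¹-cong = negP-cong }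
          ; comm = +P-comm }
        ; *-cong = *P-cong
        ; *-assoc = *P-assoc
        ; *-identity = *P-identityˡ , (λ p → ≈P-trans (*P-comm p 1P) (*P-identityˡ p))
        ; distrib = *P-distribˡ , *P-distribʳ }
      ; *-comm = *P-comm }
    }

  private
    module P = CommutativeRing polyCommutativeRing

  constP-isRingHomomorphism : IsRingHomomorphism rawRing P.rawRing constP
  constP-isRingHomomorphism = record
    { isSemiringHomomorphism = record
      { isNearSemiringHomomorphism = record
        { +-isMonoidHomomorphism = record
          { isMagmaHomomorphism = record
            { isRelHomomorphism = record { cong = λ e → cons e nil }
            ; homo = λ x y → ≈P-refl }
          ; ε-homo = 0∷[]≈P[] }
        ; *-homo = λ x y → cons (sym (+-identityʳ _)) nil }
      ; 1#-homo = ≈P-refl }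
    ; -‿homo = λ x → ≈P-refl }

  eval : Carrier → Poly → Carrier
  eval s []      = 0#
  eval s (x ∷ p) = x + s * eval s p

  module _ (s : Carrier) where
    eval-cong : ∀ {p q} → p ≈P q → eval s p ≈ eval s q
    eval-cong nil        = refl
    eval-cong (nilˡ e r) = sym (trans (+-cong (sym e) (trans (*-congˡ (sym (eval-cong r))) (zeroʳ s))) (+-identityˡ 0#))
    eval-cong (nilʳ e r) = trans (+-cong e (trans (*-congˡ (eval-cong r)) (zeroʳ s))) (+-identityˡ 0#)
    eval-cong (cons e r) = +-cong e (*-congˡ (eval-cong r))

    eval-+P : ∀ p q → eval s (p +P q) ≈ eval s p + eval s q
    eval-+P []      q       = sym (+-identityˡ _)
    eval-+P (x ∷ p) []      = sym (+-identityʳ _)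
    eval-+P (x ∷ p) (y ∷ q) = begin
      (x + y) + s * eval s (p +P q)              ≈⟨ +-congˡ (*-congˡ (eval-+P p q)) ⟩
      (x + y) + s * (eval s p + eval s q)
        ≈⟨ solve 5 (λ x y s a b → ((x :+ y) :+ (s :* (a :+ b))) := ((x :+ (s :* a)) :+ (y :+ (s :* b)))) refl x y s _ _ ⟩
      (x + s * eval s p) + (y + s * eval s q)    ∎
      where open ≈-Reasoning setoid

    eval-scaleP : ∀ a p → eval s (scaleP a p) ≈ a * eval s p
    eval-scaleP a []      = sym (zeroʳ a)
    eval-scaleP a (x ∷ p) = begin
      a * x + s * eval s (scaleP a p)    ≈⟨ +-congˡ (*-congˡ (eval-scaleP a p)) ⟩
      a * x + s * (a * eval s p)         ≈⟨ solve 4 (λ a x s e → ((a :* x) :+ (s :* (a :* e))) := (a :* (x :+ (s :* e)))) refl a x s _ ⟩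
      a * (x + s * eval s p)             ∎
      where open ≈-Reasoning setoid

    eval-*P : ∀ p q → eval s (p *P q) ≈ eval s p * eval s q
    eval-*P []      q = sym (zeroˡ _)
    eval-*P (x ∷ p) q = begin
      eval s (scaleP x q +P (0# ∷ (p *P q)))             ≈⟨ eval-+P (scaleP x q) (0# ∷ (p *P q)) ⟩
      eval s (scaleP x q) + (0# + s * eval s (p *P q))   ≈⟨ +-cong (eval-scaleP x q) (+-identityˡ _) ⟩
      x * eval s q + s * eval s (p *P q)                 ≈⟨ +-congˡ (*-congˡ (eval-*P p q)) ⟩
      x * eval s q + s * (eval s p * eval s q)
        ≈⟨ solve 4 (λ x s a b → ((x :* b) :+ (s :* (a :* b))) := ((x :+ (s :* a)) :* b)) refl x s _ _ ⟩
      (x + s * eval s p) * eval s q                      ∎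
      where open ≈-Reasoning setoid

    eval-negP : ∀ p → eval s (negP p) ≈ - eval s p
    eval-negP []      = sym -0#≈0#
    eval-negP (x ∷ p) = begin
      - x + s * eval s (negP p)    ≈⟨ +-congˡ (*-congˡ (eval-negP p)) ⟩
      - x + s * - eval s p         ≈⟨ +-congˡ (-‿distribʳ-* s _) ⟨
      - x + - (s * eval s p)       ≈⟨ -‿+-comm x _ ⟩
      - (x + s * eval s p)         ∎
      where open ≈-Reasoning setoid

    eval-constP : ∀ x → eval s (constP x) ≈ x
    eval-constP x = trans (+-congˡ (zeroʳ s)) (+-identityʳ x)

    eval-Xλ : eval s Xλ ≈ s
    eval-Xλ = trans (+-identityˡ _) (trans (*-congˡ (eval-constP 1#)) (*-identityʳ s))

    eval-isRingHomomorphism : IsRingHomomorphism P.rawRing rawRing (eval s)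
    eval-isRingHomomorphism = record
      { isSemiringHomomorphism = record
        { isNearSemiringHomomorphism = record
          { +-isMonoidHomomorphism = record
            { isMagmaHomomorphism = record
              { isRelHomomorphism = record { cong = eval-cong }
              ; homo = eval-+P }
            ; ε-homo = refl }
          ; *-homo = eval-*P }
        ; 1#-homo = eval-constP 1# }
      ; -‿homo = eval-negP }

  Xλ-*P : ∀ p → (Xλ *P p) ≈P (0# ∷ p)
  Xλ-*P p = ≈P-trans (+P-cong (scaleP-zeroˡ p refl) ≈P-refl) (cons refl (*P-identityˡ p))

  Xλ^-*P-cancelˡ : ∀ k {p q} → ((Xλ ^P k) *P p) ≈P ((Xλ ^P k) *P q) → p ≈P q
  Xλ^-*P-cancelˡ zero    {p} {q} e = P.trans (P.sym (*P-identityˡ p)) (P.trans e (*P-identityˡ q))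
  Xλ^-*P-cancelˡ (suc k) {p} {q} e = Xλ^-*P-cancelˡ k (cancel-Xλ (begin
    Xλ *P ((Xλ ^P k) *P p)    ≈⟨ P.*-assoc Xλ (Xλ ^P k) p ⟨
    (Xλ ^P suc k) *P p        ≈⟨ e ⟩
    (Xλ ^P suc k) *P q        ≈⟨ P.*-assoc Xλ (Xλ ^P k) q ⟩
    Xλ *P ((Xλ ^P k) *P q)    ∎))
    where
    open ≈-Reasoning P.setoid
    cancel-Xλ : ∀ {p q} → (Xλ *P p) ≈P (Xλ *P q) → p ≈P q
    cancel-Xλ {p} {q} e with ≈P-trans (≈P-sym (Xλ-*P p)) (≈P-trans e (Xλ-*P q))
    ... | cons _ r = r

module AdjacentTransposition where

  swapAdjacent : ∀ {m} → Fin m → Fin (suc m) → Fin (suc m)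
  swapAdjacent zero    zero          = suc zero
  swapAdjacent zero    (suc zero)    = zero
  swapAdjacent zero    (suc (suc k)) = suc (suc k)
  swapAdjacent (suc c) zero          = zero
  swapAdjacent (suc c) (suc k)       = suc (swapAdjacent c k)

  swapAdjacent-involutive : ∀ {m} (c : Fin m) k → swapAdjacent c (swapAdjacent c k) ≡ k
  swapAdjacent-involutive zero    zero          = ≡.refl
  swapAdjacent-involutive zero    (suc zero)    = ≡.refl
  swapAdjacent-involutive zero    (suc (suc k)) = ≡.refl
  swapAdjacent-involutive (suc c) zero          = ≡.refl
  swapAdjacent-involutive (suc c) (suc k)       = ≡.cong suc (swapAdjacent-involutive c k)

  swapAdjacent-inject₁ : ∀ {m} (c : Fin m) → swapAdjacent c (inject₁ c) ≡ suc c
  swapAdjacent-inject₁ zero    = ≡.refl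
  swapAdjacent-inject₁ (suc c) = ≡.cong suc (swapAdjacent-inject₁ c)

  swapAdjacent-suc : ∀ {m} (c : Fin m) → swapAdjacent c (suc c) ≡ inject₁ c
  swapAdjacent-suc zero    = ≡.refl
  swapAdjacent-suc (suc c) = ≡.cong suc (swapAdjacent-suc c)

  swapAdjacent-other : ∀ {m} (c : Fin m) k → k ≢ inject₁ c → k ≢ suc c → swapAdjacent c k ≡ k
  swapAdjacent-other zero    zero          p q = ⊥-elim (p ≡.refl)
  swapAdjacent-other zero    (suc zero)    p q = ⊥-elim (q ≡.refl)
  swapAdjacent-other zero    (suc (suc k)) p q = ≡.refl
  swapAdjacent-other (suc c) zero          p q = ≡.refl
  swapAdjacent-other (suc c) (suc k)       p q =
    ≡.cong suc (swapAdjacent-other c k (p ∘ ≡.cong suc) (q ∘ ≡.cong suc))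

  swapAdjacent-punchIn-inject₁ : ∀ {m} (c : Fin m) k →
    swapAdjacent c (punchIn (inject₁ c) k) ≡ punchIn (suc c) k
  swapAdjacent-punchIn-inject₁ zero    zero    = ≡.refl
  swapAdjacent-punchIn-inject₁ zero    (suc k) = ≡.refl
  swapAdjacent-punchIn-inject₁ (suc c) zero    = ≡.refl
  swapAdjacent-punchIn-inject₁ (suc c) (suc k) = ≡.cong suc (swapAdjacent-punchIn-inject₁ c k)

  swapAdjacent-punchIn-suc : ∀ {m} (c : Fin m) k →
    swapAdjacent c (punchIn (suc c) k) ≡ punchIn (inject₁ c) k
  swapAdjacent-punchIn-suc c k =
    ≡.trans (≡.cong (swapAdjacent c) (≡.sym (swapAdjacent-punchIn-inject₁ c k))) (swapAdjacent-involutive c _)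

  punchIn-adjacent : ∀ {m} (c : Fin m) k →
    punchIn (inject₁ c) k ≡ punchIn (suc c) k ⊎ (punchIn (inject₁ c) k ≡ suc c × punchIn (suc c) k ≡ inject₁ c)
  punchIn-adjacent zero    zero    = inj₂ (≡.refl , ≡.refl)
  punchIn-adjacent zero    (suc k) = inj₁ ≡.refl
  punchIn-adjacent (suc c) zero    = inj₁ ≡.refl
  punchIn-adjacent (suc c) (suc k) with punchIn-adjacent c k
  ... | inj₁ e       = inj₁ (≡.cong suc e)
  ... | inj₂ (e , f) = inj₂ (≡.cong suc e , ≡.cong suc f)

  -- Away from the swapped pair, deleting the column j turns the transposition of
  -- (c, c + 1) into the transposition of an adjacent pair c′ of the minor.
  record SwapAdjacentPastPunchIn {m} (j : Fin (suc (suc m))) (c : Fin (suc m)) : Set where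
    field
      c′                   : Fin m
      swapAdjacent-punchIn : ∀ k → swapAdjacent c (punchIn j k) ≡ punchIn j (swapAdjacent c′ k)
      punchIn-inject₁      : punchIn j (inject₁ c′) ≡ inject₁ c
      punchIn-suc          : punchIn j (suc c′) ≡ suc c

  swapAdjacentPastPunchIn : ∀ {m} (j : Fin (suc (suc m))) (c : Fin (suc m)) →
    j ≢ inject₁ c → j ≢ suc c → SwapAdjacentPastPunchIn j c
  swapAdjacentPastPunchIn zero          zero    p q = ⊥-elim (p ≡.refl)
  swapAdjacentPastPunchIn zero          (suc c) p q = record
    { c′ = c ; swapAdjacent-punchIn = λ k → ≡.refl ; punchIn-inject₁ = ≡.refl ; punchIn-suc = ≡.refl }
  swapAdjacentPastPunchIn (suc zero)    zero    p q = ⊥-elim (q ≡.refl)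
  swapAdjacentPastPunchIn {zero}  (suc (suc ())) zero p q
  swapAdjacentPastPunchIn {suc m} (suc (suc j)) zero p q = record
    { c′ = zero ; swapAdjacent-punchIn = commute ; punchIn-inject₁ = ≡.refl ; punchIn-suc = ≡.refl }
    where
    commute : ∀ k → swapAdjacent zero (punchIn (suc (suc j)) k) ≡ punchIn (suc (suc j)) (swapAdjacent zero k)
    commute zero          = ≡.refl
    commute (suc zero)    = ≡.refl
    commute (suc (suc k)) = ≡.refl
  swapAdjacentPastPunchIn {suc m} (suc j) (suc c) p q = record
    { c′ = suc c′
    ; swapAdjacent-punchIn = commute
    ; punchIn-inject₁ = ≡.cong suc punchIn-inject₁
    ; punchIn-suc = ≡.cong suc punchIn-suc }
    where
    open SwapAdjacentPastPunchIn (swapAdjacentPastPunchIn j c (λ e → p (≡.cong suc e)) (λ e → q (≡.cong suc e)))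
    commute : ∀ k → swapAdjacent (suc c) (punchIn (suc j) k) ≡ punchIn (suc j) (swapAdjacent (suc c′) k)
    commute zero    = ≡.refl
    commute (suc k) = ≡.cong suc (swapAdjacent-punchIn k)

module FinSplit where

  data View (m n : ℕ) : Fin (m ℕ.+ n) → Set where
    left  : (a : Fin m) → View m n (a ↑ˡ n)
    right : (b : Fin n) → View m n (m ↑ʳ b)

  view : ∀ m n (i : Fin (m ℕ.+ n)) → View m n i
  view m n i with splitAt m i in eq
  ... | inj₁ a = ≡.subst (View m n) (splitAt⁻¹-↑ˡ eq) (left a)
  ... | inj₂ b = ≡.subst (View m n) (splitAt⁻¹-↑ʳ eq) (right b)

  toℕ-↑ˡ-< : ∀ {m} n (a : Fin m) → toℕ (a ↑ˡ n) ℕ.< m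
  toℕ-↑ˡ-< n a = ≡.subst (ℕ._< _) (≡.sym (toℕ-↑ˡ a n)) (toℕ<n a)

  toℕ-↑ʳ-≥ : ∀ m {n} (b : Fin n) → m ℕ.≤ toℕ (m ↑ʳ b)
  toℕ-↑ʳ-≥ m b = ≡.subst (m ℕ.≤_) (≡.sym (toℕ-↑ʳ m b)) (ℕ.m≤m+n m (toℕ b))

  ↑ˡ≢↑ʳ : ∀ {m n} (a : Fin m) (b : Fin n) → a ↑ˡ n ≢ m ↑ʳ b
  ↑ˡ≢↑ʳ {m} a b e = ℕ.<⇒≱ (toℕ-↑ˡ-< _ a) (≡.subst (λ k → m ℕ.≤ toℕ k) (≡.sym e) (toℕ-↑ʳ-≥ m b))

  toℕ-punchIn-< : ∀ {n} (i : Fin (suc n)) (j : Fin n) → toℕ j ℕ.< toℕ i → toℕ (punchIn i j) ≡ toℕ j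
  toℕ-punchIn-< zero    j       ()
  toℕ-punchIn-< (suc i) zero    j<i          = ≡.refl
  toℕ-punchIn-< (suc i) (suc j) (ℕ.s≤s j<i) = ≡.cong suc (toℕ-punchIn-< i j j<i)

  toℕ-punchIn-≤ : ∀ {n} (i : Fin (suc n)) (j : Fin n) → toℕ (punchIn i j) ℕ.≤ suc (toℕ j)
  toℕ-punchIn-≤ zero    j       = ℕ.≤-refl
  toℕ-punchIn-≤ (suc i) zero    = ℕ.z≤n
  toℕ-punchIn-≤ (suc i) (suc j) = ℕ.s≤s (toℕ-punchIn-≤ i j)

  punchIn-↑ˡ : ∀ {p} q (i : Fin (suc p)) (j : Fin p) → punchIn (i ↑ˡ q) (j ↑ˡ q) ≡ punchIn i j ↑ˡ q
  punchIn-↑ˡ q zero    j       = ≡.refl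
  punchIn-↑ˡ q (suc i) zero    = ≡.refl
  punchIn-↑ˡ q (suc i) (suc j) = ≡.cong suc (punchIn-↑ˡ q i j)

  punchIn-↑ʳ : ∀ p {q} (i : Fin (suc p)) (j : Fin q) → punchIn (i ↑ˡ q) (p ↑ʳ j) ≡ suc p ↑ʳ j
  punchIn-↑ʳ zero    zero    j = ≡.refl
  punchIn-↑ʳ (suc p) zero    j = ≡.refl
  punchIn-↑ʳ (suc p) (suc i) j = ≡.cong suc (punchIn-↑ʳ p i j)

  ⌊≟⌋-injective : ∀ {m n} (f : Fin m → Fin n) → (∀ {a b} → f a ≡ f b → a ≡ b) →
    ∀ i j → ⌊ f i Fin.≟ f j ⌋ ≡ ⌊ i Fin.≟ j ⌋
  ⌊≟⌋-injective f f-inj i j with i Fin.≟ j | f i Fin.≟ f j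
  ... | yes _   | yes _   = ≡.refl
  ... | yes i≡j | no fi≢fj = ⊥-elim (fi≢fj (≡.cong f i≡j))
  ... | no i≢j  | yes fi≡fj = ⊥-elim (i≢j (f-inj fi≡fj))
  ... | no _    | no _    = ≡.refl

  ⌊≟⌋-≢ : ∀ {n} {i j : Fin n} → i ≢ j → ⌊ i Fin.≟ j ⌋ ≡ false
  ⌊≟⌋-≢ {i = i} {j} i≢j with i Fin.≟ j
  ... | yes i≡j = ⊥-elim (i≢j i≡j)
  ... | no _    = ≡.refl

module MatrixAlgebra {c ℓ} (R : CommutativeRing c ℓ) where
  open Over R
  open CommutativeRing R hiding (Carrier; _≈_; _+_; _*_; -_; 0#; 1#; zero)
  open RingProperties ring using (-0#≈0#; -‿+-comm)
  open AdjacentTransposition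
  open NaturalCoefficientsSolver commutativeSemiring using (solve; _:+_; _:*_; _:=_)

  ≈M-setoid : ℕ → ℕ → Setoid c ℓ
  ≈M-setoid m n = ≋-setoid (≋-setoid setoid n) m
    where open VectorSetoid using (≋-setoid)

  sumF-cong : ∀ n {f g : Fin n → Carrier} → (∀ j → f j ≈ g j) → sumF n f ≈ sumF n g
  sumF-cong zero    h = refl
  sumF-cong (suc n) h = +-cong (h zero) (sumF-cong n (λ j → h (suc j)))

  sumF-zero : ∀ n {f : Fin n → Carrier} → (∀ j → f j ≈ 0#) → sumF n f ≈ 0#
  sumF-zero zero    h = refl
  sumF-zero (suc n) h = trans (+-cong (h zero) (sumF-zero n (λ j → h (suc j)))) (+-identityˡ 0#)

  sumF-+ : ∀ n (f g : Fin n → Carrier) → sumF n (λ j → f j + g j) ≈ sumF n f + sumF n g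
  sumF-+ zero    f g = sym (+-identityˡ 0#)
  sumF-+ (suc n) f g = begin
    (f zero + g zero) + sumF n (λ j → f (suc j) + g (suc j))  ≈⟨ +-congˡ (sumF-+ n (λ j → f (suc j)) (λ j → g (suc j))) ⟩
    (f zero + g zero) + (sumF n (f ∘ suc) + sumF n (g ∘ suc))
      ≈⟨ solve 4 (λ a b c d → ((a :+ b) :+ (c :+ d)) := ((a :+ c) :+ (b :+ d))) refl _ _ _ _ ⟩
    (f zero + sumF n (f ∘ suc)) + (g zero + sumF n (g ∘ suc)) ∎
    where open ≈-Reasoning setoid

  sumF-neg : ∀ n (f : Fin n → Carrier) → sumF n (λ j → - f j) ≈ - sumF n f
  sumF-neg zero    f = sym -0#≈0#
  sumF-neg (suc n) f = trans (+-congˡ (sumF-neg n (λ j → f (suc j)))) (-‿+-comm _ _)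

  sumF-*ˡ : ∀ n a (f : Fin n → Carrier) → sumF n (λ j → a * f j) ≈ a * sumF n f
  sumF-*ˡ zero    a f = sym (zeroʳ a)
  sumF-*ˡ (suc n) a f = trans (+-congˡ (sumF-*ˡ n a (λ j → f (suc j)))) (sym (distribˡ a _ _))

  sumF-*ʳ : ∀ n a (f : Fin n → Carrier) → sumF n (λ j → f j * a) ≈ sumF n f * a
  sumF-*ʳ n a f = trans (sumF-cong n (λ j → *-comm (f j) a)) (trans (sumF-*ˡ n a f) (*-comm a _))

  sumF-linear : ∀ n a b (f g : Fin n → Carrier) → sumF n (λ j → a * f j + b * g j) ≈ a * sumF n f + b * sumF n g
  sumF-linear n a b f g = trans (sumF-+ n _ _) (+-cong (sumF-*ˡ n a f) (sumF-*ˡ n b g))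

  sumF-↑ : ∀ m n (f : Fin (m ℕ.+ n) → Carrier) →
    sumF (m ℕ.+ n) f ≈ sumF m (λ j → f (j ↑ˡ n)) + sumF n (λ k → f (m ↑ʳ k))
  sumF-↑ zero    n f = sym (+-identityˡ _)
  sumF-↑ (suc m) n f = trans (+-congˡ (sumF-↑ m n (λ j → f (suc j)))) (sym (+-assoc _ _ _))

  sumF-comm : ∀ m n (f : Fin m → Fin n → Carrier) →
    sumF m (λ i → sumF n (λ j → f i j)) ≈ sumF n (λ j → sumF m (λ i → f i j))
  sumF-comm zero    n f = sym (sumF-zero n (λ j → refl))
  sumF-comm (suc m) n f = trans (+-congˡ (sumF-comm m n (λ i → f (suc i))))
    (sym (sumF-+ n (λ j → f zero j) (λ j → sumF m (λ i → f (suc i) j))))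

  sumF-swapAdjacent : ∀ {m} (c : Fin m) (f : Fin (suc m) → Carrier) →
    sumF (suc m) (λ j → f (swapAdjacent c j)) ≈ sumF (suc m) f
  sumF-swapAdjacent {suc m} zero    f = trans (sym (+-assoc _ _ _)) (trans (+-congʳ (+-comm _ _)) (+-assoc _ _ _))
  sumF-swapAdjacent {suc m} (suc c) f = +-congˡ (sumF-swapAdjacent c (λ j → f (suc j)))

  sumF-adjacentSupport : ∀ {m} (c : Fin m) (f : Fin (suc m) → Carrier) →
    (∀ j → j ≢ inject₁ c → j ≢ suc c → f j ≈ 0#) → sumF (suc m) f ≈ f (inject₁ c) + f (suc c)
  sumF-adjacentSupport {suc m} zero    f z =
    +-congˡ (trans (+-congˡ (sumF-zero m (λ j → z (suc (suc j)) (λ ()) (λ ())))) (+-identityʳ _))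
  sumF-adjacentSupport {suc m} (suc c) f z = trans (+-congʳ (z zero (λ ()) (λ ()))) (trans (+-identityˡ _)
    (sumF-adjacentSupport c (λ j → f (suc j)) (λ j p q → z (suc j) (p ∘ suc-injective) (q ∘ suc-injective))))

  Id-diagonal : ∀ {n} (i : Fin n) → Id n i i ≈ 1#
  Id-diagonal i with i Fin.≟ i
  ... | yes _ = refl
  ... | no p  = ⊥-elim (p ≡.refl)

  Id-offDiagonal : ∀ {n} (i j : Fin n) → i ≢ j → Id n i j ≈ 0#
  Id-offDiagonal i j q with i Fin.≟ j
  ... | yes p = ⊥-elim (q p)
  ... | no _  = refl

  Id-suc : ∀ {n} (i j : Fin n) → Id (suc n) (suc i) (suc j) ≈ Id n i j
  Id-suc i j with i Fin.≟ j
  ... | yes _ = refl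
  ... | no _  = refl

  Id-sym : ∀ {n} (i j : Fin n) → Id n i j ≈ Id n j i
  Id-sym i j with i Fin.≟ j
  ... | yes ≡.refl = sym (Id-diagonal i)
  ... | no p       = sym (Id-offDiagonal j i (λ e → p (≡.sym e)))

  sumF-Idˡ : ∀ n (i : Fin n) (f : Fin n → Carrier) → sumF n (λ j → Id n i j * f j) ≈ f i
  sumF-Idˡ (suc n) zero    f = trans (+-cong (*-identityˡ _) (sumF-zero n (λ j → zeroˡ _))) (+-identityʳ _)
  sumF-Idˡ (suc n) (suc i) f = trans (+-cong (zeroˡ _) (sumF-cong n (λ j → *-congʳ (Id-suc i j))))
    (trans (+-identityˡ _) (sumF-Idˡ n i (λ j → f (suc j))))

  sumF-Idʳ : ∀ n (i : Fin n) (f : Fin n → Carrier) → sumF n (λ j → f j * Id n j i) ≈ f i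
  sumF-Idʳ n i f = trans (sumF-cong n (λ j → trans (*-comm _ _) (*-congʳ (Id-sym j i)))) (sumF-Idˡ n i f)

  ⊛-cong : ∀ {m n p} {A A′ : Mat Carrier m n} {B B′ : Mat Carrier n p} → A ≈M A′ → B ≈M B′ → (A ⊛ B) ≈M (A′ ⊛ B′)
  ⊛-cong {n = n} eA eB i k = sumF-cong n (λ j → *-cong (eA i j) (eB j k))

  ⊛-assoc : ∀ {m n p r} (A : Mat Carrier m n) (B : Mat Carrier n p) (C : Mat Carrier p r) →
    ((A ⊛ B) ⊛ C) ≈M (A ⊛ (B ⊛ C))
  ⊛-assoc {n = n} {p = p} A B C i l = begin
    sumF p (λ k → sumF n (λ j → A i j * B j k) * C k l)      ≈⟨ sumF-cong p (λ k → sym (sumF-*ʳ n (C k l) _)) ⟩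
    sumF p (λ k → sumF n (λ j → (A i j * B j k) * C k l))    ≈⟨ sumF-cong p (λ k → sumF-cong n (λ j → *-assoc _ _ _)) ⟩
    sumF p (λ k → sumF n (λ j → A i j * (B j k * C k l)))    ≈⟨ sumF-comm p n _ ⟩
    sumF n (λ j → sumF p (λ k → A i j * (B j k * C k l)))    ≈⟨ sumF-cong n (λ j → sumF-*ˡ p (A i j) _) ⟩
    sumF n (λ j → A i j * sumF p (λ k → B j k * C k l))      ∎
    where open ≈-Reasoning setoid

  ⊛-identityˡ : ∀ {m n} (A : Mat Carrier m n) → (Id m ⊛ A) ≈M A
  ⊛-identityˡ {m} A i k = sumF-Idˡ m i (λ j → A j k)

  ⊛-identityʳ : ∀ {m n} (A : Mat Carrier m n) → (A ⊛ Id n) ≈M A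
  ⊛-identityʳ {n = n} A i k = sumF-Idʳ n k (λ j → A i j)

  ⊛-cancel-conjugate : ∀ {m n} (X⁻¹ X : Mat Carrier m m) (Y : Mat Carrier m n) (Z⁻¹ Z : Mat Carrier n n) →
    (X⁻¹ ⊛ X) ≈M Id m → (Z⁻¹ ⊛ Z) ≈M Id n → ((X⁻¹ ⊛ ((X ⊛ Y) ⊛ Z⁻¹)) ⊛ Z) ≈M Y
  ⊛-cancel-conjugate {m} {n} X⁻¹ X Y Z⁻¹ Z X⁻¹X≈I Z⁻¹Z≈I = begin
    (X⁻¹ ⊛ ((X ⊛ Y) ⊛ Z⁻¹)) ⊛ Z   ≈⟨ ⊛-assoc X⁻¹ ((X ⊛ Y) ⊛ Z⁻¹) Z ⟩
    X⁻¹ ⊛ (((X ⊛ Y) ⊛ Z⁻¹) ⊛ Z)   ≈⟨ ⊛-cong {A = X⁻¹} ≈M-refl (⊛-assoc (X ⊛ Y) Z⁻¹ Z) ⟩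
    X⁻¹ ⊛ ((X ⊛ Y) ⊛ (Z⁻¹ ⊛ Z))   ≈⟨ ⊛-cong {A = X⁻¹} ≈M-refl (⊛-cong {A = X ⊛ Y} ≈M-refl Z⁻¹Z≈I) ⟩
    X⁻¹ ⊛ ((X ⊛ Y) ⊛ Id n)        ≈⟨ ⊛-cong {A = X⁻¹} ≈M-refl (⊛-identityʳ (X ⊛ Y)) ⟩
    X⁻¹ ⊛ (X ⊛ Y)                 ≈⟨ ⊛-assoc X⁻¹ X Y ⟨
    (X⁻¹ ⊛ X) ⊛ Y                 ≈⟨ ⊛-cong {B = Y} X⁻¹X≈I ≈M-refl ⟩
    Id m ⊛ Y                      ≈⟨ ⊛-identityˡ Y ⟩
    Y                             ∎
    where
    open ≈-Reasoning (≈M-setoid _ _)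
    ≈M-refl : ∀ {m n} {A : Mat Carrier m n} → A ≈M A
    ≈M-refl _ _ = refl

module Determinant {c ℓ} (R : CommutativeRing c ℓ) where
  open import Data.Vec.Functional using (_∷_; tail)
  open Over R
  open CommutativeRing R hiding (Carrier; _≈_; _+_; _*_; -_; 0#; 1#; zero)
  open RingProperties ring using (-‿involutive; -‿distribˡ-*; -‿distribʳ-*)
  open NaturalCoefficientsSolver commutativeSemiring using (solve; _:+_; _:*_; _:=_)
  open AdjacentTransposition
  open MatrixAlgebra R
  open FinSplit

  private
    *-distrib-combination : ∀ a b s x y → s * (a * x + b * y) ≈ a * (s * x) + b * (s * y)
    *-distrib-combination = solve 5 (λ a b s x y → (s :* (a :* x :+ b :* y)) := (a :* (s :* x) :+ b :* (s :* y))) refl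

    combination-*-distrib : ∀ a b x y d → (a * x + b * y) * d ≈ a * (x * d) + b * (y * d)
    combination-*-distrib = solve 5 (λ a b x y d → ((a :* x :+ b :* y) :* d) := (a :* (x :* d) :+ b :* (y :* d))) refl

  sign : ∀ {n} → Fin n → Carrier
  sign zero    = 1#
  sign (suc j) = - sign j

  sign-inject₁ : ∀ {m} (c : Fin m) → sign (inject₁ c) ≈ sign c
  sign-inject₁ zero    = refl
  sign-inject₁ (suc c) = -‿cong (sign-inject₁ c)

  sign-↑ˡ : ∀ {m} (j : Fin m) n → sign (j ↑ˡ n) ≈ sign j
  sign-↑ˡ zero    n = refl
  sign-↑ˡ (suc j) n = -‿cong (sign-↑ˡ j n)

  sign-inject₁≈-sign-suc : ∀ {m} (c : Fin m) → sign (inject₁ c) ≈ - sign (suc c)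
  sign-inject₁≈-sign-suc c = trans (sign-inject₁ c) (sym (-‿involutive _))

  minor : ∀ {n} → Mat Carrier (suc n) (suc n) → Fin (suc n) → Mat Carrier n n
  minor M j i k = M (suc i) (punchIn j k)

  reindexColumns : ∀ {r m n} → (Fin n → Fin m) → Mat Carrier r m → Mat Carrier r n
  reindexColumns f A i k = A i (f k)

  altSum : ∀ n → (Fin (suc n) → Carrier) → Carrier
  altSum = DetOps.altSum _+_ _*_ -_ 0# 1#

  altSum-cong : ∀ n {f g} → (∀ j → f j ≈ g j) → altSum n f ≈ altSum n g
  altSum-cong zero    h = h zero
  altSum-cong (suc n) h = +-cong (h zero) (-‿cong (altSum-cong n (λ j → h (suc j))))

  altSum≈sumF : ∀ n f → altSum n f ≈ sumF (suc n) (λ j → sign j * f j)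
  altSum≈sumF zero    f = sym (trans (+-identityʳ _) (*-identityˡ _))
  altSum≈sumF (suc n) f = +-cong (sym (*-identityˡ _)) (begin
    - altSum n (λ j → f (suc j))                         ≈⟨ -‿cong (altSum≈sumF n (λ j → f (suc j))) ⟩
    - sumF (suc n) (λ j → sign j * f (suc j))            ≈⟨ sumF-neg (suc n) (λ j → sign j * f (suc j)) ⟨
    sumF (suc n) (λ j → - (sign j * f (suc j)))          ≈⟨ sumF-cong (suc n) (λ j → -‿distribˡ-* (sign j) (f (suc j))) ⟩
    sumF (suc n) (λ j → - sign j * f (suc j))            ∎)
    where open ≈-Reasoning setoid

  det-expand : ∀ n M → det (suc n) M ≈ sumF (suc n) (λ j → sign j * (M zero j * det n (minor M j)))
  det-expand n M = altSum≈sumF n _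

  det-cong : ∀ n {A B : Mat Carrier n n} → A ≈M B → det n A ≈ det n B
  det-cong zero    e = refl
  det-cong (suc n) e = altSum-cong n (λ j → *-cong (e zero j) (det-cong n (λ i k → e (suc i) (punchIn j k))))

  det-linearInColumn : ∀ n (A B C : Mat Carrier n n) (col : Fin n) (a b : Carrier) →
    (∀ i k → k ≢ col → A i k ≈ C i k) → (∀ i k → k ≢ col → B i k ≈ C i k) →
    (∀ i → C i col ≈ a * A i col + b * B i col) → det n C ≈ a * det n A + b * det n B
  det-linearInColumn (suc n) A B C col a b hA hB hC = begin
    det (suc n) C                                           ≈⟨ det-expand n C ⟩
    sumF (suc n) (term C)                                   ≈⟨ sumF-cong (suc n) term-linear ⟩
    sumF (suc n) (λ j → a * term A j + b * term B j)        ≈⟨ sumF-linear (suc n) a b (term A) (term B) ⟩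
    a * sumF (suc n) (term A) + b * sumF (suc n) (term B)   ≈⟨ +-cong (*-congˡ (det-expand n A)) (*-congˡ (det-expand n B)) ⟨
    a * det (suc n) A + b * det (suc n) B                   ∎
    where
    open ≈-Reasoning setoid
    term : Mat Carrier (suc n) (suc n) → Fin (suc n) → Carrier
    term M j = sign j * (M zero j * det n (minor M j))
    term-linear : ∀ j → term C j ≈ a * term A j + b * term B j
    term-linear j with j Fin.≟ col
    ... | yes ≡.refl = trans (*-congˡ (begin
      C zero j * det n (minor C j)                              ≈⟨ *-cong (hC zero) (det-cong n minorC≈minorA) ⟩
      (a * A zero j + b * B zero j) * det n (minor A j)         ≈⟨ combination-*-distrib a b _ _ _ ⟩
      a * (A zero j * det n (minor A j)) + b * (B zero j * det n (minor A j))
                                                                ≈⟨ +-congˡ (*-congˡ (*-congˡ (det-cong n minorA≈minorB))) ⟩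
      a * (A zero j * det n (minor A j)) + b * (B zero j * det n (minor B j)) ∎))
      (*-distrib-combination a b _ _ _)
      where
      minorC≈minorA : minor C j ≈M minor A j
      minorC≈minorA i k = sym (hA (suc i) (punchIn j k) (punchInᵢ≢i j k))
      minorA≈minorB : minor A j ≈M minor B j
      minorA≈minorB i k = trans (hA (suc i) (punchIn j k) (punchInᵢ≢i j k)) (sym (hB (suc i) (punchIn j k) (punchInᵢ≢i j k)))
    ... | no j≢col = trans (*-congˡ (begin
      C zero j * det n (minor C j)                               ≈⟨ *-congˡ minor-linear ⟩
      C zero j * (a * det n (minor A j) + b * det n (minor B j)) ≈⟨ *-distrib-combination a b _ _ _ ⟩
      a * (C zero j * det n (minor A j)) + b * (C zero j * det n (minor B j))
        ≈⟨ +-cong (*-congˡ (*-congʳ (sym (hA zero j j≢col)))) (*-congˡ (*-congʳ (sym (hB zero j j≢col)))) ⟩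
      a * (A zero j * det n (minor A j)) + b * (B zero j * det n (minor B j)) ∎))
      (*-distrib-combination a b _ _ _)
      where
      col′ : Fin n
      col′ = punchOut j≢col
      punchIn-col′ : punchIn j col′ ≡ col
      punchIn-col′ = punchIn-punchOut j≢col
      off-col′ : ∀ k → k ≢ col′ → punchIn j k ≢ col
      off-col′ k k≢col′ e = k≢col′ (≡.trans (≡.sym (punchOut-punchIn j)) (punchOut-cong j e))
      minor-linear : det n (minor C j) ≈ a * det n (minor A j) + b * det n (minor B j)
      minor-linear = det-linearInColumn n (minor A j) (minor B j) (minor C j) col′ a b
        (λ i k k≢col′ → hA (suc i) (punchIn j k) (off-col′ k k≢col′))
        (λ i k k≢col′ → hB (suc i) (punchIn j k) (off-col′ k k≢col′))
        (λ i → begin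
          C (suc i) (punchIn j col′)                                   ≡⟨ ≡.cong (C (suc i)) punchIn-col′ ⟩
          C (suc i) col                                                ≈⟨ hC (suc i) ⟩
          a * A (suc i) col + b * B (suc i) col                        ≡⟨ ≡.cong (λ k → a * A (suc i) k + b * B (suc i) k) punchIn-col′ ⟨
          a * A (suc i) (punchIn j col′) + b * B (suc i) (punchIn j col′) ∎)

  -- Expanding along the first row, the terms at the two swapped columns trade places
  -- with a sign change, and every other term changes sign by induction on the minor.
  det-swapAdjacentColumns : ∀ m (A : Mat Carrier (suc m) (suc m)) (c : Fin m) →
    det (suc m) (reindexColumns (swapAdjacent c) A) ≈ - det (suc m) A
  det-swapAdjacentColumns (suc m) A c = begin
    det (suc (suc m)) A′                                  ≈⟨ det-expand (suc m) A′ ⟩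
    sumF (suc (suc m)) (λ j → term A′ j)                  ≈⟨ sumF-cong (suc (suc m)) term-swapped ⟩
    sumF (suc (suc m)) (λ j → - term A (swapAdjacent c j)) ≈⟨ sumF-neg (suc (suc m)) (term A ∘ swapAdjacent c) ⟩
    - sumF (suc (suc m)) (λ j → term A (swapAdjacent c j)) ≈⟨ -‿cong (sumF-swapAdjacent c (term A)) ⟩
    - sumF (suc (suc m)) (term A)                         ≈⟨ -‿cong (det-expand (suc m) A) ⟨
    - det (suc (suc m)) A                                 ∎
    where
    open ≈-Reasoning setoid
    A′ : Mat Carrier (suc (suc m)) (suc (suc m))
    A′ = reindexColumns (swapAdjacent c) A
    term : Mat Carrier (suc (suc m)) (suc (suc m)) → Fin (suc (suc m)) → Carrier
    term M j = sign j * (M zero j * det (suc m) (minor M j))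
    term-at : ∀ {j j′} → j ≡ j′ → term A j ≈ term A j′
    term-at e = reflexive (≡.cong (term A) e)
    term-swapped : ∀ j → term A′ j ≈ - term A (swapAdjacent c j)
    term-swapped j with j Fin.≟ inject₁ c | j Fin.≟ suc c
    ... | yes ≡.refl | _ = begin
      sign (inject₁ c) * (A zero (swapAdjacent c (inject₁ c)) * det (suc m) (minor A′ (inject₁ c)))
        ≈⟨ *-cong (sign-inject₁≈-sign-suc c) (*-cong (reflexive (≡.cong (A zero) (swapAdjacent-inject₁ c)))
             (det-cong (suc m) (λ i k → reflexive (≡.cong (A (suc i)) (swapAdjacent-punchIn-inject₁ c k))))) ⟩
      - sign (suc c) * (A zero (suc c) * det (suc m) (minor A (suc c)))
        ≈⟨ -‿distribˡ-* _ _ ⟨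
      - term A (suc c)
        ≈⟨ -‿cong (term-at (≡.sym (swapAdjacent-inject₁ c))) ⟩
      - term A (swapAdjacent c (inject₁ c)) ∎
    ... | no _ | yes ≡.refl = begin
      sign (suc c) * (A zero (swapAdjacent c (suc c)) * det (suc m) (minor A′ (suc c)))
        ≈⟨ *-cong (-‿cong (sym (sign-inject₁ c))) (*-cong (reflexive (≡.cong (A zero) (swapAdjacent-suc c)))
             (det-cong (suc m) (λ i k → reflexive (≡.cong (A (suc i)) (swapAdjacent-punchIn-suc c k))))) ⟩
      - sign (inject₁ c) * (A zero (inject₁ c) * det (suc m) (minor A (inject₁ c)))
        ≈⟨ -‿distribˡ-* _ _ ⟨
      - term A (inject₁ c)
        ≈⟨ -‿cong (term-at (≡.sym (swapAdjacent-suc c))) ⟩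
      - term A (swapAdjacent c (suc c)) ∎
    ... | no p | no q = begin
      sign j * (A zero (swapAdjacent c j) * det (suc m) (minor A′ j))
        ≈⟨ *-congˡ (*-cong (reflexive (≡.cong (A zero) (swapAdjacent-other c j p q)))
             (trans (det-cong (suc m) (λ i k → reflexive (≡.cong (A (suc i)) (swapAdjacent-punchIn k))))
                    (det-swapAdjacentColumns m (minor A j) c′))) ⟩
      sign j * (A zero j * - det (suc m) (minor A j))
        ≈⟨ trans (-‿distribʳ-* _ _) (*-congˡ (-‿distribʳ-* _ _)) ⟨
      - term A j
        ≈⟨ -‿cong (term-at (≡.sym (swapAdjacent-other c j p q))) ⟩
      - term A (swapAdjacent c j) ∎
      where open SwapAdjacentPastPunchIn (swapAdjacentPastPunchIn j c p q)

  -- Only the two terms at the equal columns survive the first-row expansion, and they cancel.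
  det-equalAdjacentColumns : ∀ m (A : Mat Carrier (suc m) (suc m)) (c : Fin m) →
    (∀ i → A i (inject₁ c) ≈ A i (suc c)) → det (suc m) A ≈ 0#
  det-equalAdjacentColumns (suc m) A c eq = begin
    det (suc (suc m)) A                 ≈⟨ det-expand (suc m) A ⟩
    sumF (suc (suc m)) term             ≈⟨ sumF-adjacentSupport c term term-other ⟩
    term (inject₁ c) + term (suc c)     ≈⟨ +-cong (*-cong (sign-inject₁≈-sign-suc c) pair) refl ⟩
    - sign (suc c) * x + sign (suc c) * x ≈⟨ +-congʳ (-‿distribˡ-* _ _) ⟨
    - (sign (suc c) * x) + sign (suc c) * x ≈⟨ -‿inverseˡ _ ⟩
    0#                                  ∎
    where
    open ≈-Reasoning setoid
    term : Fin (suc (suc m)) → Carrier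
    term j = sign j * (A zero j * det (suc m) (minor A j))
    x : Carrier
    x = A zero (suc c) * det (suc m) (minor A (suc c))
    term-other : ∀ j → j ≢ inject₁ c → j ≢ suc c → term j ≈ 0#
    term-other j p q = trans (*-congˡ (trans (*-congˡ minor-vanishes) (zeroʳ _))) (zeroʳ _)
      where
      open SwapAdjacentPastPunchIn (swapAdjacentPastPunchIn j c p q)
      minor-vanishes : det (suc m) (minor A j) ≈ 0#
      minor-vanishes = det-equalAdjacentColumns m (minor A j) c′ (λ i → begin
        A (suc i) (punchIn j (inject₁ c′)) ≡⟨ ≡.cong (A (suc i)) punchIn-inject₁ ⟩
        A (suc i) (inject₁ c)             ≈⟨ eq (suc i) ⟩
        A (suc i) (suc c)                 ≡⟨ ≡.cong (A (suc i)) punchIn-suc ⟨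
        A (suc i) (punchIn j (suc c′))    ∎)
    equal-minors : minor A (inject₁ c) ≈M minor A (suc c)
    equal-minors i k with punchIn-adjacent c k
    ... | inj₁ e       = reflexive (≡.cong (A (suc i)) e)
    ... | inj₂ (e , f) = trans (reflexive (≡.cong (A (suc i)) e))
                           (trans (sym (eq (suc i))) (reflexive (≡.cong (A (suc i)) (≡.sym f))))
    pair : A zero (inject₁ c) * det (suc m) (minor A (inject₁ c)) ≈ x
    pair = *-cong (eq zero) (det-cong (suc m) equal-minors)

  det-firstRow-singleEntry : ∀ n (M : Mat Carrier (suc n) (suc n)) → (∀ j → M zero (suc j) ≈ 0#) →
    det (suc n) M ≈ M zero zero * det n (minor M zero)
  det-firstRow-singleEntry n M h = begin
    det (suc n) M                                                              ≈⟨ det-expand n M ⟩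
    1# * (M zero zero * det n (minor M zero)) + sumF n (λ j → term (suc j))   ≈⟨ +-cong (*-identityˡ _) (sumF-zero n off-zero) ⟩
    M zero zero * det n (minor M zero) + 0#                                    ≈⟨ +-identityʳ _ ⟩
    M zero zero * det n (minor M zero)                                         ∎
    where
    open ≈-Reasoning setoid
    term : Fin (suc n) → Carrier
    term j = sign j * (M zero j * det n (minor M j))
    off-zero : ∀ j → term (suc j) ≈ 0#
    off-zero j = trans (*-congˡ (trans (*-congʳ (h j)) (zeroˡ _))) (zeroʳ _)

  det-Id : ∀ n → det n (Id n) ≈ 1#
  det-Id zero    = refl
  det-Id (suc n) = begin
    det (suc n) (Id (suc n))                    ≈⟨ det-firstRow-singleEntry n (Id (suc n)) (λ j → refl) ⟩
    1# * det n (minor (Id (suc n)) zero)        ≈⟨ *-identityˡ _ ⟩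
    det n (minor (Id (suc n)) zero)             ≈⟨ det-cong n Id-suc ⟩
    det n (Id n)                                ≈⟨ det-Id n ⟩
    1#                                          ∎
    where open ≈-Reasoning setoid

  record ColumnMultilinear {r n} (D : Mat Carrier r n → Carrier) : Set (c ⊔ ℓ) where
    field
      D-cong   : ∀ {A B} → A ≈M B → D A ≈ D B
      D-linear : ∀ (A B C : Mat Carrier r n) (col : Fin n) (a b : Carrier) →
        (∀ i k → k ≢ col → A i k ≈ C i k) → (∀ i k → k ≢ col → B i k ≈ C i k) →
        (∀ i → C i col ≈ a * A i col + b * B i col) → D C ≈ a * D A + b * D B
  open ColumnMultilinear

  det-multilinear : ∀ n → ColumnMultilinear (det n)
  det-multilinear n = record { D-cong = det-cong n ; D-linear = det-linearInColumn n }

  prependColumn : ∀ {r n} → (Fin r → Carrier) → Mat Carrier r n → Mat Carrier r (suc n)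
  prependColumn x M i = x i ∷ M i

  tailColumns : ∀ {r n} → Mat Carrier r (suc n) → Mat Carrier r n
  tailColumns M i = tail (M i)

  prependColumn-multilinear : ∀ {r n} {D : Mat Carrier r (suc n) → Carrier} → ColumnMultilinear D →
    (x : Fin r → Carrier) → ColumnMultilinear (λ M → D (prependColumn x M))
  prependColumn-multilinear ml x = record
    { D-cong = λ e → D-cong ml λ { i zero → refl ; i (suc k) → e i k }
    ; D-linear = λ A B C col a b hA hB hC →
        D-linear ml (prependColumn x A) (prependColumn x B) (prependColumn x C) (suc col) a b
          (λ { i zero _ → refl ; i (suc k) q → hA i k (q ∘ ≡.cong suc) })
          (λ { i zero _ → refl ; i (suc k) q → hB i k (q ∘ ≡.cong suc) })
          hC }

  multilinear-firstColumn : ∀ {r n} {D : Mat Carrier r (suc n) → Carrier} → ColumnMultilinear D →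
    ∀ m (w : Fin m → Carrier) (a : Fin m → Fin r → Carrier) (M : Mat Carrier r (suc n)) →
    (∀ i → M i zero ≈ sumF m (λ j → w j * a j i)) →
    D M ≈ sumF m (λ j → w j * D (prependColumn (a j) (tailColumns M)))
  multilinear-firstColumn {D = D} ml zero w a M h = begin
    D M                     ≈⟨ D-linear ml M M M zero 0# 0# (λ _ _ _ → refl) (λ _ _ _ → refl) (λ i → trans (h i) (sym 0·+0·≈0)) ⟩
    0# * D M + 0# * D M     ≈⟨ 0·+0·≈0 ⟩
    0#                      ∎
    where
    open ≈-Reasoning setoid
    0·+0·≈0 : ∀ {x y} → 0# * x + 0# * y ≈ 0#
    0·+0·≈0 = trans (+-cong (zeroˡ _) (zeroˡ _)) (+-identityˡ 0#)
  multilinear-firstColumn {D = D} ml (suc m) w a M h = begin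
    D M
      ≈⟨ D-linear ml (prependColumn (a zero) M′) (prependColumn rest M′) M zero (w zero) 1#
           (λ { i zero q → ⊥-elim (q ≡.refl) ; i (suc k) q → refl })
           (λ { i zero q → ⊥-elim (q ≡.refl) ; i (suc k) q → refl })
           (λ i → trans (h i) (+-congˡ (sym (*-identityˡ _)))) ⟩
    w zero * D (prependColumn (a zero) M′) + 1# * D (prependColumn rest M′)
      ≈⟨ +-congˡ (trans (*-identityˡ _)
           (multilinear-firstColumn ml m (w ∘ suc) (a ∘ suc) (prependColumn rest M′) (λ i → refl))) ⟩
    w zero * D (prependColumn (a zero) M′) + sumF m (λ j → w (suc j) * D (prependColumn (a (suc j)) M′))
      ∎
    where
    open ≈-Reasoning setoid
    M′ = tailColumns M
    rest : Fin _ → Carrier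
    rest i = sumF m (λ j → w (suc j) * a (suc j) i)

  sumMaps : ∀ n m → ((Fin n → Fin m) → Carrier) → Carrier
  sumMaps zero    m g = g (λ ())
  sumMaps (suc n) m g = sumF m (λ j → sumMaps n m (λ f → g (j ∷ f)))

  sumMaps-cong : ∀ n m {g h : (Fin n → Fin m) → Carrier} → (∀ f → g f ≈ h f) → sumMaps n m g ≈ sumMaps n m h
  sumMaps-cong zero    m e = e _
  sumMaps-cong (suc n) m e = sumF-cong m (λ j → sumMaps-cong n m (λ f → e (j ∷ f)))

  sumMaps-*ˡ : ∀ n m a (g : (Fin n → Fin m) → Carrier) → sumMaps n m (λ f → a * g f) ≈ a * sumMaps n m g
  sumMaps-*ˡ zero    m a g = refl
  sumMaps-*ˡ (suc n) m a g = trans (sumF-cong m (λ j → sumMaps-*ˡ n m a _)) (sumF-*ˡ m a _)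

  sumMaps-*ʳ : ∀ n m a (g : (Fin n → Fin m) → Carrier) → sumMaps n m (λ f → g f * a) ≈ sumMaps n m g * a
  sumMaps-*ʳ n m a g = trans (sumMaps-cong n m (λ f → *-comm _ a)) (trans (sumMaps-*ˡ n m a g) (*-comm a _))

  prodF : ∀ n → (Fin n → Carrier) → Carrier
  prodF zero    f = 1#
  prodF (suc n) f = f zero * prodF n (f ∘ suc)

  prodF-cong : ∀ n {f g : Fin n → Carrier} → (∀ k → f k ≈ g k) → prodF n f ≈ prodF n g
  prodF-cong zero    e = refl
  prodF-cong (suc n) e = *-cong (e zero) (prodF-cong n (e ∘ suc))

  multilinear-expansion : ∀ {r} n {D : Mat Carrier r n → Carrier} → ColumnMultilinear D →
    ∀ m (a : Fin m → Fin r → Carrier) (B : Mat Carrier m n) (M : Mat Carrier r n) →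
    (∀ i k → M i k ≈ sumF m (λ j → B j k * a j i)) →
    D M ≈ sumMaps n m (λ f → prodF n (λ k → B (f k) k) * D (λ i k → a (f k) i))
  multilinear-expansion zero    {D} ml m a B M h = trans (D-cong ml (λ i ())) (sym (*-identityˡ _))
  multilinear-expansion (suc n) {D} ml m a B M h =
    trans (multilinear-firstColumn ml m (λ j → B j zero) a M (λ i → h i zero))
      (sumF-cong m λ j → begin
        B j zero * D′ j (tailColumns M)
          ≈⟨ *-congˡ (multilinear-expansion n (prependColumn-multilinear ml (a j)) m a
                        (λ j′ k → B j′ (suc k)) (tailColumns M) (λ i k → h i (suc k))) ⟩
        B j zero * sumMaps n m (λ f → prodF n (λ k → B (f k) (suc k)) * D′ j (λ i k → a (f k) i))
          ≈⟨ sumMaps-*ˡ n m (B j zero) _ ⟨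
        sumMaps n m (λ f → B j zero * (prodF n (λ k → B (f k) (suc k)) * D′ j (λ i k → a (f k) i)))
          ≈⟨ sumMaps-cong n m (λ f → trans (sym (*-assoc _ _ _)) (*-congˡ (D-cong ml (prepend-map j f)))) ⟩
        sumMaps n m (λ f → prodF (suc n) (λ k → B ((j ∷ f) k) k) * D (λ i k → a ((j ∷ f) k) i)) ∎)
    where
    open ≈-Reasoning setoid
    D′ : Fin m → Mat Carrier _ n → Carrier
    D′ j N = D (prependColumn (a j) N)
    prepend-map : ∀ j f → prependColumn (a j) (λ i k → a (f k) i) ≈M (λ i k → a ((j ∷ f) k) i)
    prepend-map j f i zero    = refl
    prepend-map j f i (suc k) = refl

  -- Holds for every f (detFactors, by sorting f with adjacent swaps), which is all that the
  -- product formula det-⊛ needs.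
  DetFactors : ∀ {n} → Mat Carrier n n → (Fin n → Fin n) → Set ℓ
  DetFactors {n} A f = det n (reindexColumns f A) ≈ det n (reindexColumns f (Id n)) * det n A

  DetFactors-cong : ∀ {n} A {f g : Fin n → Fin n} → (∀ k → f k ≡ g k) → DetFactors A f → DetFactors A g
  DetFactors-cong {n} A e p =
    trans (det-cong n (λ i k → reflexive (≡.cong (A i) (≡.sym (e k)))))
      (trans p (*-congʳ (det-cong n (λ i k → reflexive (≡.cong (Id n i) (e k))))))

  DetFactors-swapAdjacent : ∀ {n} A (f : Fin (suc n) → Fin (suc n)) (c : Fin n) →
    DetFactors A f → DetFactors A (f ∘ swapAdjacent c)
  DetFactors-swapAdjacent {n} A f c p = begin
    det (suc n) (reindexColumns (f ∘ swapAdjacent c) A)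
      ≈⟨ det-swapAdjacentColumns n (reindexColumns f A) c ⟩
    - det (suc n) (reindexColumns f A)
      ≈⟨ -‿cong p ⟩
    - (det (suc n) (reindexColumns f (Id (suc n))) * det (suc n) A)
      ≈⟨ -‿distribˡ-* _ _ ⟩
    - det (suc n) (reindexColumns f (Id (suc n))) * det (suc n) A
      ≈⟨ *-congʳ (det-swapAdjacentColumns n (reindexColumns f (Id (suc n))) c) ⟨
    det (suc n) (reindexColumns (f ∘ swapAdjacent c) (Id (suc n))) * det (suc n) A ∎
    where open ≈-Reasoning setoid

  DetFactors-repeatAdjacent : ∀ {n} A (f : Fin (suc n) → Fin (suc n)) (c : Fin n) →
    f (inject₁ c) ≡ f (suc c) → DetFactors A f
  DetFactors-repeatAdjacent {n} A f c e =
    trans (det-equalAdjacentColumns n (reindexColumns f A) c (λ i → reflexive (≡.cong (A i) e)))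
      (sym (trans (*-congʳ (det-equalAdjacentColumns n (reindexColumns f (Id (suc n))) c (λ i → reflexive (≡.cong (Id (suc n) i) e))))
                  (zeroˡ _)))

  DetFactors-id : ∀ {n} A (f : Fin n → Fin n) → (∀ k → f k ≡ k) → DetFactors A f
  DetFactors-id {n} A f e =
    trans (det-cong n (λ i k → reflexive (≡.cong (A i) (e k))))
      (sym (trans (*-congʳ (trans (det-cong n (λ i k → reflexive (≡.cong (Id n i) (e k)))) (det-Id n))) (*-identityˡ _)))

  -- A repeated value at distance d + 1 is moved next to its twin by d adjacent swaps.
  DetFactors-repeat : ∀ d {n} (A : Mat Carrier n n) (f : Fin n → Fin n) (i j : Fin n) →
    toℕ j ≡ suc (d ℕ.+ toℕ i) → f i ≡ f j → DetFactors A f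
  DetFactors-repeat d       A f i zero () _
  DetFactors-repeat zero    {suc n} A f i (suc c) e q = DetFactors-repeatAdjacent A f c (≡.trans (≡.cong f (≡.sym i≡c)) q)
    where
    i≡c : i ≡ inject₁ c
    i≡c = toℕ-injective (≡.trans (≡.sym (ℕ.suc-injective e)) (≡.sym (toℕ-inject₁ c)))
  DetFactors-repeat (suc d) {suc n} A f i (suc c) e q =
    DetFactors-cong A (λ k → ≡.cong f (swapAdjacent-involutive c k)) (DetFactors-swapAdjacent A g c (DetFactors-repeat d A g i (inject₁ c)
      (≡.trans (toℕ-inject₁ c) c≡) (≡.trans (≡.cong f (swapAdjacent-other c i i≢inject₁c i≢suc-c))
                                     (≡.trans q (≡.cong f (≡.sym (swapAdjacent-inject₁ c)))))))
    where
    g : Fin (suc n) → Fin (suc n)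
    g = f ∘ swapAdjacent c
    c≡ : toℕ c ≡ suc (d ℕ.+ toℕ i)
    c≡ = ℕ.suc-injective e
    i≢inject₁c : i ≢ inject₁ c
    i≢inject₁c x = ℕ.m≢1+n+m (toℕ i) (≡.trans (≡.cong toℕ x) (≡.trans (toℕ-inject₁ c) c≡))
    i≢suc-c : i ≢ suc c
    i≢suc-c x = ℕ.m≢1+n+m (toℕ i) (≡.trans (≡.cong toℕ x) e)

  FixesBelow : ∀ {n} → ℕ → (Fin n → Fin n) → Set
  FixesBelow m f = ∀ k → toℕ k ℕ.< m → f k ≡ k

  -- The position p carrying the value m is moved down to position m by adjacent swaps,
  -- which keep the positions below m fixed.
  DetFactors-bubble : ∀ d {n} (A : Mat Carrier n n) m (mF : Fin n) → toℕ mF ≡ m → (∀ g → FixesBelow (suc m) g → DetFactors A g) →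
    ∀ f (p : Fin n) → FixesBelow m f → f p ≡ mF → toℕ p ≡ d ℕ.+ m → DetFactors A f
  DetFactors-bubble zero A m mF mF≡m fixes-suc-m f p fixes fp≡mF p≡m = fixes-suc-m f fixes′
    where
    fixes′ : FixesBelow (suc m) f
    fixes′ k (ℕ.s≤s k≤m) with ℕ.m≤n⇒m<n∨m≡n k≤m
    ... | inj₁ k<m = fixes k k<m
    ... | inj₂ k≡m = ≡.trans (≡.cong f (toℕ-injective (≡.trans k≡m (≡.sym p≡m))))
                       (≡.trans fp≡mF (toℕ-injective (≡.trans mF≡m (≡.sym k≡m))))
  DetFactors-bubble (suc d) A m mF mF≡m fixes-suc-m f zero fixes fp≡mF ()
  DetFactors-bubble (suc d) {suc n} A m mF mF≡m fixes-suc-m f (suc c) fixes fp≡mF p≡ =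
    DetFactors-cong A (λ k → ≡.cong f (swapAdjacent-involutive c k)) (DetFactors-swapAdjacent A g c
      (DetFactors-bubble d A m mF mF≡m fixes-suc-m g (inject₁ c) fixes-g
        (≡.trans (≡.cong f (swapAdjacent-inject₁ c)) fp≡mF) (≡.trans (toℕ-inject₁ c) c≡)))
    where
    g : Fin (suc n) → Fin (suc n)
    g = f ∘ swapAdjacent c
    c≡ : toℕ c ≡ d ℕ.+ m
    c≡ = ℕ.suc-injective p≡
    fixes-g : FixesBelow m g
    fixes-g k k<m = ≡.trans (≡.cong f (swapAdjacent-other c k k≢inject₁c k≢suc-c)) (fixes k k<m)
      where
      k≢inject₁c : k ≢ inject₁ c
      k≢inject₁c x = ℕ.m+n≮n d m (≡.subst (ℕ._< m) (≡.trans (≡.cong toℕ x) (≡.trans (toℕ-inject₁ c) c≡)) k<m)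
      k≢suc-c : k ≢ suc c
      k≢suc-c x = ℕ.m+n≮n (suc d) m (≡.subst (ℕ._< m) (≡.trans (≡.cong toℕ x) p≡) k<m)

  -- Either the value m is attained (bubble it into place) or, by pigeonhole, f repeats a value.
  DetFactors-extendFixed : ∀ {n} (A : Mat Carrier n n) m → m ℕ.< n → (∀ g → FixesBelow (suc m) g → DetFactors A g) →
    ∀ f → FixesBelow m f → DetFactors A f
  DetFactors-extendFixed {suc n} A m m<n fixes-suc-m f fixes with any? (λ p → f p Fin.≟ fromℕ< m<n)
  ... | yes (p , fp≡m) =
    DetFactors-bubble (toℕ p ℕ.∸ m) A m (fromℕ< m<n) (toℕ-fromℕ< m<n) fixes-suc-m f p fixes fp≡m
      (≡.sym (ℕ.m∸n+n≡m m≤p))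
    where
    m≤p : m ℕ.≤ toℕ p
    m≤p = ℕ.≮⇒≥ (λ p<m → ℕ.<-irrefl (≡.trans (≡.cong toℕ (≡.trans (≡.sym (fixes p p<m)) fp≡m)) (toℕ-fromℕ< m<n)) p<m)
  ... | no m∉f with pigeonhole (ℕ.n<1+n n) (λ k → punchOut {i = fromℕ< m<n} {j = f k} (λ x → m∉f (k , ≡.sym x)))
  ...   | i , j , i<j , eq =
    DetFactors-repeat (toℕ j ℕ.∸ suc (toℕ i)) A f i j
      (≡.sym (≡.trans (≡.sym (ℕ.+-suc (toℕ j ℕ.∸ suc (toℕ i)) (toℕ i))) (ℕ.m∸n+n≡m i<j)))
      (punchOut-injective {i = fromℕ< m<n} (λ x → m∉f (i , ≡.sym x)) (λ x → m∉f (j , ≡.sym x)) eq)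

  DetFactors-fromFixed : ∀ d {n} (A : Mat Carrier n n) m → m ℕ.+ d ≡ n → ∀ f → FixesBelow m f → DetFactors A f
  DetFactors-fromFixed zero    A m e f fixes =
    DetFactors-id A f (λ k → fixes k (≡.subst (toℕ k ℕ.<_) (≡.trans (≡.sym e) (ℕ.+-identityʳ m)) (toℕ<n k)))
  DetFactors-fromFixed (suc d) A m e f fixes =
    DetFactors-extendFixed A m (≡.subst (m ℕ.<_) e (ℕ.m<m+n m (ℕ.s≤s ℕ.z≤n)))
      (DetFactors-fromFixed d A (suc m) (≡.trans (≡.sym (ℕ.+-suc m d)) e)) f fixes

  detFactors : ∀ {n} A (f : Fin n → Fin n) → DetFactors A f
  detFactors {n} A f = DetFactors-fromFixed n A 0 ≡.refl f (λ k ())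

  det-⊛ : ∀ n (A B : Mat Carrier n n) → det n (A ⊛ B) ≈ det n A * det n B
  det-⊛ n A B = begin
    det n (A ⊛ B)
      ≈⟨ multilinear-expansion n (det-multilinear n) n (λ j i → A i j) B (A ⊛ B) (λ i k → sumF-cong n (λ j → *-comm _ _)) ⟩
    sumMaps n n (λ f → prodF n (λ k → B (f k) k) * det n (reindexColumns f A))
      ≈⟨ sumMaps-cong n n (λ f → trans (*-congˡ (detFactors A f)) (sym (*-assoc _ _ _))) ⟩
    sumMaps n n (λ f → (prodF n (λ k → B (f k) k) * det n (reindexColumns f (Id n))) * det n A)
      ≈⟨ sumMaps-*ʳ n n (det n A) _ ⟩
    sumMaps n n (λ f → prodF n (λ k → B (f k) k) * det n (reindexColumns f (Id n))) * det n A
      ≈⟨ *-congʳ (multilinear-expansion n (det-multilinear n) n (λ j i → Id n i j) B B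
                    (λ i k → sym (trans (sumF-cong n (λ j → *-comm _ _)) (sumF-Idˡ n i (λ j → B j k))))) ⟨
    det n B * det n A
      ≈⟨ *-comm _ _ ⟩
    det n A * det n B ∎
    where open ≈-Reasoning setoid

  -- The last n − a rows vanish on the first a + 1 columns, so they are linearly dependent.
  det-oversizedZeroBlock : ∀ a n (N : Mat Carrier n n) → a ℕ.< n →
    (∀ i j → a ℕ.≤ toℕ i → toℕ j ℕ.≤ a → N i j ≈ 0#) → det n N ≈ 0#
  det-oversizedZeroBlock zero (suc n) N _ h = begin
    det (suc n) N                             ≈⟨ det-expand n N ⟩
    term zero + sumF n (λ j → term (suc j))   ≈⟨ +-cong term-zero (sumF-zero n term-suc) ⟩
    0# + 0#                                   ≈⟨ +-identityʳ 0# ⟩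
    0#                                        ∎
    where
    open ≈-Reasoning setoid
    term : Fin (suc n) → Carrier
    term j = sign j * (N zero j * det n (minor N j))
    term-zero : term zero ≈ 0#
    term-zero = trans (*-congˡ (trans (*-congʳ (h zero zero ℕ.z≤n ℕ.z≤n)) (zeroˡ _))) (zeroʳ _)
    0<n : Fin n → 0 ℕ.< n
    0<n zero    = ℕ.s≤s ℕ.z≤n
    0<n (suc _) = ℕ.s≤s ℕ.z≤n
    term-suc : ∀ j → term (suc j) ≈ 0#
    term-suc j = trans (*-congˡ (trans (*-congˡ (det-oversizedZeroBlock zero n (minor N (suc j)) (0<n j)
                   (λ { i zero _ _ → h (suc i) zero ℕ.z≤n ℕ.z≤n }))) (zeroʳ _))) (zeroʳ _)
  det-oversizedZeroBlock (suc a) (suc n) N (ℕ.s≤s a<n) h = trans (det-expand n N) (sumF-zero (suc n) term-vanishes)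
    where
    term-vanishes : ∀ j → sign j * (N zero j * det n (minor N j)) ≈ 0#
    term-vanishes j = trans (*-congˡ (trans (*-congˡ (det-oversizedZeroBlock a n (minor N j) a<n
      (λ i k a≤i k≤a → h (suc i) (punchIn j k) (ℕ.s≤s a≤i) (ℕ.≤-trans (toℕ-punchIn-≤ j k) (ℕ.s≤s k≤a))))) (zeroʳ _))) (zeroʳ _)

  det-blockUpperTriangular′ : ∀ p q (M : Mat Carrier (p ℕ.+ q) (p ℕ.+ q)) →
    (∀ i j → p ℕ.≤ toℕ i → toℕ j ℕ.< p → M i j ≈ 0#) →
    det (p ℕ.+ q) M ≈ det p (λ i j → M (i ↑ˡ q) (j ↑ˡ q)) * det q (λ i j → M (p ↑ʳ i) (p ↑ʳ j))
  det-blockUpperTriangular′ zero    q M h = sym (*-identityˡ _)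
  det-blockUpperTriangular′ (suc p) q M h = begin
    det (suc p ℕ.+ q) M
      ≈⟨ det-expand (p ℕ.+ q) M ⟩
    sumF (suc p ℕ.+ q) term
      ≈⟨ sumF-↑ (suc p) q term ⟩
    sumF (suc p) (λ j → term (j ↑ˡ q)) + sumF q (λ k → term (suc p ↑ʳ k))
      ≈⟨ trans (+-congˡ (sumF-zero q right-term)) (+-identityʳ _) ⟩
    sumF (suc p) (λ j → term (j ↑ˡ q))
      ≈⟨ sumF-cong (suc p) left-term ⟩
    sumF (suc p) (λ j → termTL j * det q BR)
      ≈⟨ sumF-*ʳ (suc p) (det q BR) termTL ⟩
    sumF (suc p) termTL * det q BR
      ≈⟨ *-congʳ (det-expand p TL) ⟨
    det (suc p) TL * det q BR ∎
    where
    open ≈-Reasoning setoid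
    TL : Mat Carrier (suc p) (suc p)
    TL i j = M (i ↑ˡ q) (j ↑ˡ q)
    BR : Mat Carrier q q
    BR i j = M (suc p ↑ʳ i) (suc p ↑ʳ j)
    term : Fin (suc p ℕ.+ q) → Carrier
    term j = sign j * (M zero j * det (p ℕ.+ q) (minor M j))
    termTL : Fin (suc p) → Carrier
    termTL j = sign j * (TL zero j * det p (minor TL j))
    left-term : ∀ j → term (j ↑ˡ q) ≈ termTL j * det q BR
    left-term j = trans (*-cong (sign-↑ˡ j q) (*-congˡ (trans
      (det-blockUpperTriangular′ p q (minor M (j ↑ˡ q))
        (λ i k p≤i k<p → h (suc i) (punchIn (j ↑ˡ q) k) (ℕ.s≤s p≤i) (ℕ.≤-<-trans (toℕ-punchIn-≤ (j ↑ˡ q) k) (ℕ.s≤s k<p))))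
      (*-cong (det-cong p (λ i k → reflexive (≡.cong (M (suc (i ↑ˡ q))) (punchIn-↑ˡ q j k))))
              (det-cong q (λ i k → reflexive (≡.cong (M (suc (p ↑ʳ i))) (punchIn-↑ʳ p j k))))))))
      (trans (*-congˡ (sym (*-assoc _ _ _))) (sym (*-assoc _ _ _)))
    right-term : ∀ k → term (suc p ↑ʳ k) ≈ 0#
    right-term k = trans (*-congˡ (trans (*-congˡ (det-oversizedZeroBlock p (p ℕ.+ q) (minor M (suc p ↑ʳ k)) p<p+q
      (λ i j p≤i j≤p → h (suc i) (punchIn (suc p ↑ʳ k) j) (ℕ.s≤s p≤i)
        (≡.subst (ℕ._< suc p) (≡.sym (toℕ-punchIn-< (suc p ↑ʳ k) j (j<col j≤p))) (ℕ.s≤s j≤p))))) (zeroʳ _))) (zeroʳ _)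
      where
      p<p+q : p ℕ.< p ℕ.+ q
      p<p+q = ℕ.m<m+n p (ℕ.≤-<-trans ℕ.z≤n (toℕ<n k))
      j<col : ∀ {j} → toℕ j ℕ.≤ p → toℕ j ℕ.< toℕ (suc p ↑ʳ k)
      j<col {j} j≤p = ≡.subst (toℕ j ℕ.<_) (≡.sym (toℕ-↑ʳ (suc p) k)) (ℕ.s≤s (ℕ.≤-trans j≤p (ℕ.m≤m+n p (toℕ k))))

  det-blockUpperTriangular : ∀ p q (M : Mat Carrier (p ℕ.+ q) (p ℕ.+ q)) →
    (∀ i j → M (p ↑ʳ i) (j ↑ˡ q) ≈ 0#) →
    det (p ℕ.+ q) M ≈ det p (λ i j → M (i ↑ˡ q) (j ↑ˡ q)) * det q (λ i j → M (p ↑ʳ i) (p ↑ʳ j))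
  det-blockUpperTriangular p q M h = det-blockUpperTriangular′ p q M lower-left
    where
    lower-left : ∀ i j → p ℕ.≤ toℕ i → toℕ j ℕ.< p → M i j ≈ 0#
    lower-left i j p≤i j<p with view p q i | view p q j
    ... | left a  | _       = ⊥-elim (ℕ.<⇒≱ (toℕ-↑ˡ-< q a) p≤i)
    ... | right a | right b = ⊥-elim (ℕ.<⇒≱ j<p (toℕ-↑ʳ-≥ p b))
    ... | right a | left b  = h a b

  det-conjugate : ∀ n (C C′ X : Mat Carrier n n) → (C ⊛ C′) ≈M Id n → det n ((C ⊛ X) ⊛ C′) ≈ det n X
  det-conjugate n C C′ X CC′≈I = begin
    det n ((C ⊛ X) ⊛ C′)             ≈⟨ det-⊛ n (C ⊛ X) C′ ⟩
    det n (C ⊛ X) * det n C′         ≈⟨ *-congʳ (det-⊛ n C X) ⟩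
    (det n C * det n X) * det n C′   ≈⟨ solve 3 (λ a b d → ((a :* b) :* d) := (b :* (a :* d))) refl _ _ _ ⟩
    det n X * (det n C * det n C′)   ≈⟨ *-congˡ (det-⊛ n C C′) ⟨
    det n X * det n (C ⊛ C′)         ≈⟨ *-congˡ (trans (det-cong n CC′≈I) (det-Id n)) ⟩
    det n X * 1#                     ≈⟨ *-identityʳ _ ⟩
    det n X                          ∎
    where open ≈-Reasoning setoid

  det-permute : ∀ n (π : Fin n → Fin n) → (∀ {a b} → π a ≡ π b → a ≡ b) → (X : Mat Carrier n n) →
    det n (λ i j → X (π i) (π j)) ≈ det n X
  det-permute n π π-inj X = trans (det-cong n (λ i j → sym (PXPᵀ≈ i j))) (det-conjugate n P Pᵀ X PPᵀ≈I)
    where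
    P Pᵀ : Mat Carrier n n
    P i k = Id n (π i) k
    Pᵀ k j = Id n (π j) k
    PXPᵀ≈ : ∀ i j → ((P ⊛ X) ⊛ Pᵀ) i j ≈ X (π i) (π j)
    PXPᵀ≈ i j = trans (sumF-cong n (λ k → trans (*-congʳ (sumF-Idˡ n (π i) (λ l → X l k))) (*-comm _ _)))
                      (sumF-Idˡ n (π j) (X (π i)))
    Id-π : ∀ i j → Id n (π i) (π j) ≈ Id n i j
    Id-π i j with i Fin.≟ j
    ... | yes ≡.refl = Id-diagonal (π i)
    ... | no i≢j     = Id-offDiagonal (π i) (π j) (i≢j ∘ π-inj)
    PPᵀ≈I : (P ⊛ Pᵀ) ≈M Id n
    PPᵀ≈I i j = trans (sumF-Idˡ n (π i) (λ k → Id n (π j) k)) (trans (Id-sym (π j) (π i)) (Id-π i j))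

  conjugate-scalarMinus : ∀ n (C C′ N : Mat Carrier n n) x → (C ⊛ C′) ≈M Id n →
    ((C ⊛ (λ i j → x * Id n i j + - N i j)) ⊛ C′) ≈M (λ i j → x * Id n i j + - ((C ⊛ N) ⊛ C′) i j)
  conjugate-scalarMinus n C C′ N x CC′≈I i l = begin
    sumF n (λ k → sumF n (λ j → C i j * (x * Id n j k + - N j k)) * C′ k l)
      ≈⟨ sumF-cong n (λ k → *-congʳ left-factor) ⟩
    sumF n (λ k → (x * C i k + - (C ⊛ N) i k) * C′ k l)
      ≈⟨ sumF-cong n (λ k → solve-shape _ _ _) ⟩
    sumF n (λ k → x * (C i k * C′ k l) + - ((C ⊛ N) i k * C′ k l))
      ≈⟨ combination n _ _ ⟩
    x * (C ⊛ C′) i l + - ((C ⊛ N) ⊛ C′) i l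
      ≈⟨ +-congʳ (*-congˡ (CC′≈I i l)) ⟩
    x * Id n i l + - ((C ⊛ N) ⊛ C′) i l ∎
    where
    open ≈-Reasoning setoid
    combination : ∀ m (f g : Fin m → Carrier) → sumF m (λ j → x * f j + - g j) ≈ x * sumF m f + - sumF m g
    combination m f g = trans (sumF-+ m _ _) (+-cong (sumF-*ˡ m x f) (sumF-neg m g))
    solve-shape : ∀ a b c → (x * a + - b) * c ≈ x * (a * c) + - (b * c)
    solve-shape a b c = trans (distribʳ c _ _) (+-cong (*-assoc x a c) (sym (-‿distribˡ-* b c)))
    left-factor : ∀ {k} → sumF n (λ j → C i j * (x * Id n j k + - N j k)) ≈ x * C i k + - (C ⊛ N) i k
    left-factor {k} = trans (sumF-cong n (λ j → trans (distribˡ (C i j) _ _)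
                        (+-cong (solve 3 (λ a x b → (a :* (x :* b)) := (x :* (a :* b))) refl (C i j) x _)
                                (sym (-‿distribʳ-* (C i j) (N j k))))))
                      (trans (combination n _ _) (+-congʳ (*-congˡ (sumF-Idʳ n k (C i)))))

  diagonal : ∀ {n} → (Fin n → Carrier) → Mat Carrier n n
  diagonal {n} d i j = d i * Id n i j

  det-diagonal : ∀ n (d : Fin n → Carrier) → det n (diagonal d) ≈ prodF n d
  det-diagonal zero    d = refl
  det-diagonal (suc n) d = begin
    det (suc n) (diagonal d)                          ≈⟨ det-firstRow-singleEntry n (diagonal d) (λ j → zeroʳ (d zero)) ⟩
    d zero * 1# * det n (minor (diagonal d) zero)     ≈⟨ *-cong (*-identityʳ _) (det-cong n (λ i k → *-congˡ (Id-suc i k))) ⟩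
    d zero * det n (diagonal (d ∘ suc))               ≈⟨ *-congˡ (det-diagonal n (d ∘ suc)) ⟩
    d zero * prodF n (d ∘ suc)                        ∎
    where open ≈-Reasoning setoid

  diagonal-⊛ : ∀ {n} (d : Fin n → Carrier) (Y : Mat Carrier n n) i j → (diagonal d ⊛ Y) i j ≈ d i * Y i j
  diagonal-⊛ {n} d Y i j =
    trans (sumF-cong n (λ k → *-assoc _ _ _)) (trans (sumF-*ˡ n (d i) _) (*-congˡ (sumF-Idˡ n i (λ k → Y k j))))

  ⊛-diagonal : ∀ {n} (d : Fin n → Carrier) (Y : Mat Carrier n n) i j → (Y ⊛ diagonal d) i j ≈ Y i j * d j
  ⊛-diagonal {n} d Y i j = trans (sumF-cong n (λ k → sym (*-assoc _ _ _))) (sumF-Idʳ n j (λ k → Y i k * d k))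

module RingHomomorphism {c₁ ℓ₁ c₂ ℓ₂} (R₁ : CommutativeRing c₁ ℓ₁) (R₂ : CommutativeRing c₂ ℓ₂)
  {φ : CommutativeRing.Carrier R₁ → CommutativeRing.Carrier R₂}
  (φ-isRingHomomorphism : IsRingHomomorphism (CommutativeRing.rawRing R₁) (CommutativeRing.rawRing R₂) φ) where
  private
    module O₁ = Over R₁
    module O₂ = Over R₂
    module R₂ = CommutativeRing R₂
  open IsRingHomomorphism φ-isRingHomomorphism
  open MatrixAlgebra R₂ using (sumF-cong)
  open Determinant R₂ using (altSum-cong)

  sumF-homo : ∀ n (f : Fin n → O₁.Carrier) → φ (O₁.sumF n f) O₂.≈ O₂.sumF n (φ ∘ f)
  sumF-homo zero    f = 0#-homo
  sumF-homo (suc n) f = R₂.trans (+-homo _ _) (R₂.+-congˡ (sumF-homo n (f ∘ suc)))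

  det-homo : ∀ n (M : Mat O₁.Carrier n n) → φ (O₁.det n M) O₂.≈ O₂.det n (λ i j → φ (M i j))
  det-homo zero    M = 1#-homo
  det-homo (suc n) M = R₂.trans (altSum-homo n _)
    (altSum-cong n (λ j → R₂.trans (*-homo _ _) (R₂.*-congˡ (det-homo n (λ i k → M (suc i) (punchIn j k))))))
    where
    altSum-homo : ∀ n (f : Fin (suc n) → O₁.Carrier) →
      φ (DetOps.altSum O₁._+_ O₁._*_ O₁.-_ O₁.0# O₁.1# n f) O₂.≈ DetOps.altSum O₂._+_ O₂._*_ O₂.-_ O₂.0# O₂.1# n (φ ∘ f)
    altSum-homo zero    f = R₂.refl
    altSum-homo (suc n) f = R₂.trans (+-homo _ _) (R₂.+-congˡ (R₂.trans (-‿homo _) (R₂.-‿cong (altSum-homo n (f ∘ suc)))))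

  ⊛-homo : ∀ {m n p} (A : Mat O₁.Carrier m n) (B : Mat O₁.Carrier n p) i k →
    φ ((A O₁.⊛ B) i k) O₂.≈ ((λ a b → φ (A a b)) O₂.⊛ (λ a b → φ (B a b))) i k
  ⊛-homo {n = n} A B i k = R₂.trans (sumF-homo n _) (sumF-cong n (λ j → *-homo _ _))

module BlockPointwise {c₁ ℓ₁ c₂ ℓ₂} (R₁ : CommutativeRing c₁ ℓ₁) (R₂ : CommutativeRing c₂ ℓ₂) where
  private
    module O₁ = Over R₁
    module O₂ = Over R₂

  block-pointwise : ∀ {p} (P : O₁.Carrier → O₂.Carrier → Set p) {m₀ m₁ n₀ n₁}
    {A : Mat O₁.Carrier m₀ n₀} {B : Mat O₁.Carrier m₀ n₁} {C : Mat O₁.Carrier m₁ n₀} {D : Mat O₁.Carrier m₁ n₁}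
    {A′ : Mat O₂.Carrier m₀ n₀} {B′ : Mat O₂.Carrier m₀ n₁} {C′ : Mat O₂.Carrier m₁ n₀} {D′ : Mat O₂.Carrier m₁ n₁} →
    (∀ a b → P (A a b) (A′ a b)) → (∀ a b → P (B a b) (B′ a b)) →
    (∀ a b → P (C a b) (C′ a b)) → (∀ a b → P (D a b) (D′ a b)) →
    ∀ i j → P (O₁.block A B C D i j) (O₂.block A′ B′ C′ D′ i j)
  block-pointwise P {m₀} {n₀ = n₀} pA pB pC pD i j with splitAt m₀ i | splitAt n₀ j
  ... | inj₁ a | inj₁ b = pA a b
  ... | inj₁ a | inj₂ b = pB a b
  ... | inj₂ a | inj₁ b = pC a b
  ... | inj₂ a | inj₂ b = pD a b

module BlockMatrix {c ℓ} (R : CommutativeRing c ℓ) where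
  open Over R
  open CommutativeRing R hiding (Carrier; _≈_; _+_; _*_; -_; 0#; 1#; zero)
  open MatrixAlgebra R
  open FinSplit
  open BlockPointwise R R using (block-pointwise)

  module _ {m₀ m₁ n₀ n₁} (A : Mat Carrier m₀ n₀) (B : Mat Carrier m₀ n₁) (C : Mat Carrier m₁ n₀) (D : Mat Carrier m₁ n₁) where
    block-↑ˡ-↑ˡ : ∀ a b → block A B C D (a ↑ˡ m₁) (b ↑ˡ n₁) ≡ A a b
    block-↑ˡ-↑ˡ a b rewrite splitAt-↑ˡ m₀ a m₁ | splitAt-↑ˡ n₀ b n₁ = ≡.refl
    block-↑ˡ-↑ʳ : ∀ a b → block A B C D (a ↑ˡ m₁) (n₀ ↑ʳ b) ≡ B a b
    block-↑ˡ-↑ʳ a b rewrite splitAt-↑ˡ m₀ a m₁ | splitAt-↑ʳ n₀ n₁ b = ≡.refl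
    block-↑ʳ-↑ˡ : ∀ a b → block A B C D (m₀ ↑ʳ a) (b ↑ˡ n₁) ≡ C a b
    block-↑ʳ-↑ˡ a b rewrite splitAt-↑ʳ m₀ m₁ a | splitAt-↑ˡ n₀ b n₁ = ≡.refl
    block-↑ʳ-↑ʳ : ∀ a b → block A B C D (m₀ ↑ʳ a) (n₀ ↑ʳ b) ≡ D a b
    block-↑ʳ-↑ʳ a b rewrite splitAt-↑ʳ m₀ m₁ a | splitAt-↑ʳ n₀ n₁ b = ≡.refl

  block-cong : ∀ {m₀ m₁ n₀ n₁} {A A′ : Mat Carrier m₀ n₀} {B B′ : Mat Carrier m₀ n₁}
    {C C′ : Mat Carrier m₁ n₀} {D D′ : Mat Carrier m₁ n₁} →
    A ≈M A′ → B ≈M B′ → C ≈M C′ → D ≈M D′ → block A B C D ≈M block A′ B′ C′ D′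
  block-cong = block-pointwise _≈_

  0M : ∀ {m n} → Mat Carrier m n
  0M a b = 0#

  block-Id : ∀ p q → block (Id p) 0M 0M (Id q) ≈M Id (p ℕ.+ q)
  block-Id p q i j with view p q i | view p q j
  ... | left a  | left b  rewrite block-↑ˡ-↑ˡ (Id p) 0M 0M (Id q) a b
                                | ⌊≟⌋-injective (_↑ˡ q) (↑ˡ-injective q _ _) a b = refl
  ... | left a  | right b rewrite block-↑ˡ-↑ʳ (Id p) 0M 0M (Id q) a b | ⌊≟⌋-≢ (↑ˡ≢↑ʳ a b) = refl
  ... | right a | left b  rewrite block-↑ʳ-↑ˡ (Id p) 0M 0M (Id q) a b | ⌊≟⌋-≢ (↑ˡ≢↑ʳ b a ∘ ≡.sym) = refl
  ... | right a | right b rewrite block-↑ʳ-↑ʳ (Id p) 0M 0M (Id q) a b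
                                | ⌊≟⌋-injective (p ↑ʳ_) (↑ʳ-injective p _ _) a b = refl

  module _ {m₀ m₁} (P₀ : Mat Carrier m₀ m₀) (P₁ : Mat Carrier m₁ m₁) (v : Fin (m₀ ℕ.+ m₁) → Carrier) where
    blockDiagonal-row-↑ˡ : ∀ a →
      sumF (m₀ ℕ.+ m₁) (λ j → block P₀ 0M 0M P₁ (a ↑ˡ m₁) j * v j) ≈ sumF m₀ (λ j → P₀ a j * v (j ↑ˡ m₁))
    blockDiagonal-row-↑ˡ a = trans (sumF-↑ m₀ m₁ _) (trans (+-congˡ (sumF-zero m₁ (λ j →
      trans (*-congʳ (reflexive (block-↑ˡ-↑ʳ P₀ 0M 0M P₁ a j))) (zeroˡ _)))) (trans (+-identityʳ _)
      (sumF-cong m₀ (λ j → *-congʳ (reflexive (block-↑ˡ-↑ˡ P₀ 0M 0M P₁ a j))))))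

    blockDiagonal-row-↑ʳ : ∀ a →
      sumF (m₀ ℕ.+ m₁) (λ j → block P₀ 0M 0M P₁ (m₀ ↑ʳ a) j * v j) ≈ sumF m₁ (λ j → P₁ a j * v (m₀ ↑ʳ j))
    blockDiagonal-row-↑ʳ a = trans (sumF-↑ m₀ m₁ _) (trans (+-congʳ (sumF-zero m₀ (λ j →
      trans (*-congʳ (reflexive (block-↑ʳ-↑ˡ P₀ 0M 0M P₁ a j))) (zeroˡ _)))) (trans (+-identityˡ _)
      (sumF-cong m₁ (λ j → *-congʳ (reflexive (block-↑ʳ-↑ʳ P₀ 0M 0M P₁ a j))))))

    blockDiagonal-column-↑ˡ : ∀ b →
      sumF (m₀ ℕ.+ m₁) (λ j → v j * block P₀ 0M 0M P₁ j (b ↑ˡ m₁)) ≈ sumF m₀ (λ j → v (j ↑ˡ m₁) * P₀ j b)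
    blockDiagonal-column-↑ˡ b = trans (sumF-↑ m₀ m₁ _) (trans (+-congˡ (sumF-zero m₁ (λ j →
      trans (*-congˡ (reflexive (block-↑ʳ-↑ˡ P₀ 0M 0M P₁ j b))) (zeroʳ _)))) (trans (+-identityʳ _)
      (sumF-cong m₀ (λ j → *-congˡ (reflexive (block-↑ˡ-↑ˡ P₀ 0M 0M P₁ j b))))))

    blockDiagonal-column-↑ʳ : ∀ b →
      sumF (m₀ ℕ.+ m₁) (λ j → v j * block P₀ 0M 0M P₁ j (m₀ ↑ʳ b)) ≈ sumF m₁ (λ j → v (m₀ ↑ʳ j) * P₁ j b)
    blockDiagonal-column-↑ʳ b = trans (sumF-↑ m₀ m₁ _) (trans (+-congʳ (sumF-zero m₀ (λ j →
      trans (*-congˡ (reflexive (block-↑ˡ-↑ʳ P₀ 0M 0M P₁ j b))) (zeroʳ _)))) (trans (+-identityˡ _)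
      (sumF-cong m₁ (λ j → *-congˡ (reflexive (block-↑ʳ-↑ʳ P₀ 0M 0M P₁ j b))))))

  module _ {m₀ m₁ n₀ n₁} (A : Mat Carrier m₀ n₀) (B : Mat Carrier m₀ n₁) (C : Mat Carrier m₁ n₀) (D : Mat Carrier m₁ n₁) where
    blockDiagonal-⊛ : (P₀ : Mat Carrier m₀ m₀) (P₁ : Mat Carrier m₁ m₁) →
      (block P₀ 0M 0M P₁ ⊛ block A B C D) ≈M block (P₀ ⊛ A) (P₀ ⊛ B) (P₁ ⊛ C) (P₁ ⊛ D)
    blockDiagonal-⊛ P₀ P₁ i k with view m₀ m₁ i | view n₀ n₁ k
    ... | left a  | left b  rewrite block-↑ˡ-↑ˡ (P₀ ⊛ A) (P₀ ⊛ B) (P₁ ⊛ C) (P₁ ⊛ D) a b =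
      trans (blockDiagonal-row-↑ˡ P₀ P₁ _ a) (sumF-cong m₀ (λ j → *-congˡ (reflexive (block-↑ˡ-↑ˡ A B C D j b))))
    ... | left a  | right b rewrite block-↑ˡ-↑ʳ (P₀ ⊛ A) (P₀ ⊛ B) (P₁ ⊛ C) (P₁ ⊛ D) a b =
      trans (blockDiagonal-row-↑ˡ P₀ P₁ _ a) (sumF-cong m₀ (λ j → *-congˡ (reflexive (block-↑ˡ-↑ʳ A B C D j b))))
    ... | right a | left b  rewrite block-↑ʳ-↑ˡ (P₀ ⊛ A) (P₀ ⊛ B) (P₁ ⊛ C) (P₁ ⊛ D) a b =
      trans (blockDiagonal-row-↑ʳ P₀ P₁ _ a) (sumF-cong m₁ (λ j → *-congˡ (reflexive (block-↑ʳ-↑ˡ A B C D j b))))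
    ... | right a | right b rewrite block-↑ʳ-↑ʳ (P₀ ⊛ A) (P₀ ⊛ B) (P₁ ⊛ C) (P₁ ⊛ D) a b =
      trans (blockDiagonal-row-↑ʳ P₀ P₁ _ a) (sumF-cong m₁ (λ j → *-congˡ (reflexive (block-↑ʳ-↑ʳ A B C D j b))))

    ⊛-blockDiagonal : (P₀ : Mat Carrier n₀ n₀) (P₁ : Mat Carrier n₁ n₁) →
      (block A B C D ⊛ block P₀ 0M 0M P₁) ≈M block (A ⊛ P₀) (B ⊛ P₁) (C ⊛ P₀) (D ⊛ P₁)
    ⊛-blockDiagonal P₀ P₁ i k with view m₀ m₁ i | view n₀ n₁ k
    ... | left a  | left b  rewrite block-↑ˡ-↑ˡ (A ⊛ P₀) (B ⊛ P₁) (C ⊛ P₀) (D ⊛ P₁) a b =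
      trans (blockDiagonal-column-↑ˡ P₀ P₁ _ b) (sumF-cong n₀ (λ j → *-congʳ (reflexive (block-↑ˡ-↑ˡ A B C D a j))))
    ... | left a  | right b rewrite block-↑ˡ-↑ʳ (A ⊛ P₀) (B ⊛ P₁) (C ⊛ P₀) (D ⊛ P₁) a b =
      trans (blockDiagonal-column-↑ʳ P₀ P₁ _ b) (sumF-cong n₁ (λ j → *-congʳ (reflexive (block-↑ˡ-↑ʳ A B C D a j))))
    ... | right a | left b  rewrite block-↑ʳ-↑ˡ (A ⊛ P₀) (B ⊛ P₁) (C ⊛ P₀) (D ⊛ P₁) a b =
      trans (blockDiagonal-column-↑ˡ P₀ P₁ _ b) (sumF-cong n₀ (λ j → *-congʳ (reflexive (block-↑ʳ-↑ˡ A B C D a j))))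
    ... | right a | right b rewrite block-↑ʳ-↑ʳ (A ⊛ P₀) (B ⊛ P₁) (C ⊛ P₀) (D ⊛ P₁) a b =
      trans (blockDiagonal-column-↑ʳ P₀ P₁ _ b) (sumF-cong n₁ (λ j → *-congʳ (reflexive (block-↑ʳ-↑ʳ A B C D a j))))

  blockDiagonal-conjugate : ∀ {m₀ m₁ n₀ n₁} (L₀ : Mat Carrier m₀ m₀) (L₁ : Mat Carrier m₁ m₁)
    (A : Mat Carrier m₀ n₀) (B : Mat Carrier m₀ n₁) (C : Mat Carrier m₁ n₀) (D : Mat Carrier m₁ n₁)
    (R₀ : Mat Carrier n₀ n₀) (R₁ : Mat Carrier n₁ n₁) →
    ((block L₀ 0M 0M L₁ ⊛ block A B C D) ⊛ block R₀ 0M 0M R₁)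
      ≈M block ((L₀ ⊛ A) ⊛ R₀) ((L₀ ⊛ B) ⊛ R₁) ((L₁ ⊛ C) ⊛ R₀) ((L₁ ⊛ D) ⊛ R₁)
  blockDiagonal-conjugate L₀ L₁ A B C D R₀ R₁ i j =
    trans (⊛-cong {B = block R₀ 0M 0M R₁} (blockDiagonal-⊛ A B C D L₀ L₁) (λ _ _ → refl) i j)
          (⊛-blockDiagonal (L₀ ⊛ A) (L₀ ⊛ B) (L₁ ⊛ C) (L₁ ⊛ D) R₀ R₁ i j)

  blockDiagonal-inverse : ∀ {m₀ m₁} (L₀ R₀ : Mat Carrier m₀ m₀) (L₁ R₁ : Mat Carrier m₁ m₁) →
    (L₀ ⊛ R₀) ≈M Id m₀ → (L₁ ⊛ R₁) ≈M Id m₁ → (block L₀ 0M 0M L₁ ⊛ block R₀ 0M 0M R₁) ≈M Id (m₀ ℕ.+ m₁)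
  blockDiagonal-inverse {m₀} {m₁} L₀ R₀ L₁ R₁ L₀R₀≈I L₁R₁≈I i j =
    trans (blockDiagonal-⊛ R₀ 0M 0M R₁ L₀ L₁ i j)
      (trans (block-cong L₀R₀≈I (⊛-zeroʳ L₀) (⊛-zeroʳ L₁) L₁R₁≈I i j) (block-Id m₀ m₁ i j))
    where
    ⊛-zeroʳ : ∀ {m n p} (X : Mat Carrier m n) → (X ⊛ 0M {n} {p}) ≈M 0M
    ⊛-zeroʳ {n = n} X i j = sumF-zero n (λ k → zeroʳ _)

module KroneckerIndex where

  quotient-↑ˡ : ∀ {m} n (x : Fin n) → quotient {suc m} n (x ↑ˡ (m ℕ.* n)) ≡ zero
  quotient-↑ˡ {m} n x rewrite splitAt-↑ˡ n x (m ℕ.* n) = ≡.refl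

  remainder-↑ˡ : ∀ {m} n (x : Fin n) → remainder {suc m} n (x ↑ˡ (m ℕ.* n)) ≡ x
  remainder-↑ˡ {m} n x rewrite splitAt-↑ˡ n x (m ℕ.* n) = ≡.refl

  quotient-↑ʳ : ∀ {m} n (y : Fin (m ℕ.* n)) → quotient {suc m} n (n ↑ʳ y) ≡ suc (quotient {m} n y)
  quotient-↑ʳ {m} n y rewrite splitAt-↑ʳ n (m ℕ.* n) y = ≡.refl

  remainder-↑ʳ : ∀ {m} n (y : Fin (m ℕ.* n)) → remainder {suc m} n (n ↑ʳ y) ≡ remainder {m} n y
  remainder-↑ʳ {m} n y rewrite splitAt-↑ʳ n (m ℕ.* n) y = ≡.refl

  quotient-combine : ∀ {m} n (a : Fin m) (b : Fin n) → quotient {m} n (combine a b) ≡ a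
  quotient-combine n a b = ≡.cong proj₁ (remQuot-combine a b)

  remainder-combine : ∀ {m} n (a : Fin m) (b : Fin n) → remainder {m} n (combine a b) ≡ b
  remainder-combine n a b = ≡.cong proj₂ (remQuot-combine a b)

  quotient-remainder-injective : ∀ {m} n (i j : Fin (m ℕ.* n)) →
    quotient {m} n i ≡ quotient {m} n j → remainder {m} n i ≡ remainder {m} n j → i ≡ j
  quotient-remainder-injective {m} n i j q≡ r≡ =
    ≡.trans (≡.sym (combine-remQuot {m} n i)) (≡.trans (≡.cong₂ (combine {m} {n}) q≡ r≡) (combine-remQuot {m} n j))

module Kronecker {c ℓ} (R : CommutativeRing c ℓ) where
  open Over R
  open CommutativeRing R hiding (Carrier; _≈_; _+_; _*_; -_; 0#; 1#; zero)
  open NaturalCoefficientsSolver commutativeSemiring using (solve; _:*_; _:=_)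
  open MatrixAlgebra R
  open KroneckerIndex

  module _ {m n p q} (A : Mat Carrier (suc m) (suc n)) (B : Mat Carrier p q) where
    kron-↑ˡ-↑ˡ : ∀ x y → kron A B (x ↑ˡ (m ℕ.* p)) (y ↑ˡ (n ℕ.* q)) ≡ A zero zero * B x y
    kron-↑ˡ-↑ˡ x y rewrite quotient-↑ˡ {m} p x | remainder-↑ˡ {m} p x | quotient-↑ˡ {n} q y | remainder-↑ˡ {n} q y = ≡.refl

    kron-↑ʳ-↑ˡ : ∀ x y → kron A B (p ↑ʳ x) (y ↑ˡ (n ℕ.* q)) ≡ A (suc (quotient {m} p x)) zero * B (remainder {m} p x) y
    kron-↑ʳ-↑ˡ x y rewrite quotient-↑ʳ {m} p x | remainder-↑ʳ {m} p x | quotient-↑ˡ {n} q y | remainder-↑ˡ {n} q y = ≡.refl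

    kron-↑ʳ-↑ʳ : ∀ x y → kron A B (p ↑ʳ x) (q ↑ʳ y) ≡ kron (λ a b → A (suc a) (suc b)) B x y
    kron-↑ʳ-↑ʳ x y rewrite quotient-↑ʳ {m} p x | remainder-↑ʳ {m} p x | quotient-↑ʳ {n} q y | remainder-↑ʳ {n} q y = ≡.refl

  kron-cong : ∀ {m n p q} {A A′ : Mat Carrier m n} {B B′ : Mat Carrier p q} → A ≈M A′ → B ≈M B′ → kron A B ≈M kron A′ B′
  kron-cong eA eB i j = *-cong (eA _ _) (eB _ _)

  sumF-combine : ∀ m n (f : Fin (m ℕ.* n) → Carrier) → sumF (m ℕ.* n) f ≈ sumF m (λ a → sumF n (λ b → f (combine a b)))
  sumF-combine zero    n f = refl
  sumF-combine (suc m) n f = trans (sumF-↑ n (m ℕ.* n) f) (+-congˡ (sumF-combine m n (λ y → f (n ↑ʳ y))))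

  kron-mixedProduct : ∀ {m n r p q s} (A : Mat Carrier m n) (B : Mat Carrier p q) (C : Mat Carrier n r) (D : Mat Carrier q s) →
    (kron A B ⊛ kron C D) ≈M kron (A ⊛ C) (B ⊛ D)
  kron-mixedProduct {m} {n} {r} {p} {q} {s} A B C D i k = begin
    sumF (n ℕ.* q) (λ j → kron A B i j * kron C D j k)
      ≈⟨ sumF-combine n q _ ⟩
    sumF n (λ a → sumF q (λ b → kron A B i (combine a b) * kron C D (combine a b) k))
      ≈⟨ sumF-cong n (λ a → sumF-cong q (λ b → trans (reflexive (≡.cong₂ _*_ (entryAB a b) (entryCD a b)))
                                                     (interchange (A i₀ a) (B i₁ b) (C a k₀) (D b k₁)))) ⟩
    sumF n (λ a → sumF q (λ b → (A i₀ a * C a k₀) * (B i₁ b * D b k₁)))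
      ≈⟨ sumF-cong n (λ a → sumF-*ˡ q _ _) ⟩
    sumF n (λ a → (A i₀ a * C a k₀) * sumF q (λ b → B i₁ b * D b k₁))
      ≈⟨ sumF-*ʳ n _ _ ⟩
    sumF n (λ a → A i₀ a * C a k₀) * sumF q (λ b → B i₁ b * D b k₁) ∎
    where
    open ≈-Reasoning setoid
    i₀ : Fin m
    i₀ = quotient {m} p i
    i₁ : Fin p
    i₁ = remainder {m} p i
    k₀ : Fin r
    k₀ = quotient {r} s k
    k₁ : Fin s
    k₁ = remainder {r} s k
    entryAB : ∀ a b → kron A B i (combine a b) ≡ A i₀ a * B i₁ b
    entryAB a b = ≡.cong₂ (λ x y → A i₀ x * B i₁ y) (quotient-combine q a b) (remainder-combine q a b)
    entryCD : ∀ a b → kron C D (combine a b) k ≡ C a k₀ * D b k₁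
    entryCD a b = ≡.cong₂ (λ x y → C x k₀ * D y k₁) (quotient-combine q a b) (remainder-combine q a b)
    interchange : ∀ a b c d → (a * b) * (c * d) ≈ (a * c) * (b * d)
    interchange = solve 4 (λ a b c d → ((a :* b) :* (c :* d)) := ((a :* c) :* (b :* d))) refl

  kron-Id : ∀ m p → kron (Id m) (Id p) ≈M Id (m ℕ.* p)
  kron-Id m p i j with i Fin.≟ j
  ... | yes ≡.refl = trans (*-cong (Id-diagonal _) (Id-diagonal _)) (*-identityˡ _)
  ... | no i≢j with quotient {m} p i Fin.≟ quotient {m} p j
  ...   | no _    = zeroˡ _
  ...   | yes q≡ = trans (*-congˡ (Id-offDiagonal _ _ (i≢j ∘ quotient-remainder-injective {m} p i j q≡))) (zeroʳ _)

  kron-Id-inverse : ∀ {m} p (X Y : Mat Carrier m m) → (Y ⊛ X) ≈M Id m →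
    (kron Y (Id p) ⊛ kron X (Id p)) ≈M Id (m ℕ.* p)
  kron-Id-inverse {m} p X Y YX≈I = begin
    kron Y (Id p) ⊛ kron X (Id p)   ≈⟨ kron-mixedProduct Y (Id p) X (Id p) ⟩
    kron (Y ⊛ X) (Id p ⊛ Id p)      ≈⟨ kron-cong YX≈I (⊛-identityˡ (Id p)) ⟩
    kron (Id m) (Id p)              ≈⟨ kron-Id m p ⟩
    Id (m ℕ.* p)                    ∎
    where open ≈-Reasoning (≈M-setoid _ _)

  kron-sandwich : ∀ {m n p q} (X : Mat Carrier m m) (Y : Mat Carrier m n) (Z : Mat Carrier n n) (H : Mat Carrier p q) →
    ((kron X (Id p) ⊛ kron Y H) ⊛ kron Z (Id q)) ≈M kron ((X ⊛ Y) ⊛ Z) H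
  kron-sandwich {p = p} {q} X Y Z H = begin
    (kron X (Id p) ⊛ kron Y H) ⊛ kron Z (Id q)   ≈⟨ ⊛-cong {B = kron Z (Id q)} (kron-mixedProduct X (Id p) Y H) (λ _ _ → refl) ⟩
    kron (X ⊛ Y) (Id p ⊛ H) ⊛ kron Z (Id q)      ≈⟨ kron-mixedProduct (X ⊛ Y) (Id p ⊛ H) Z (Id q) ⟩
    kron ((X ⊛ Y) ⊛ Z) ((Id p ⊛ H) ⊛ Id q)       ≈⟨ kron-cong {A = (X ⊛ Y) ⊛ Z} (λ _ _ → refl) IHI≈H ⟩
    kron ((X ⊛ Y) ⊛ Z) H                         ∎
    where
    open ≈-Reasoning (≈M-setoid _ _)
    IHI≈H : ((Id p ⊛ H) ⊛ Id q) ≈M H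
    IHI≈H i j = trans (⊛-identityʳ (Id p ⊛ H) i j) (⊛-identityˡ H i j)

-- Conjugating by diag(1, …, 1, X, …, X) over R[X] moves the factor X from the upper right
-- block to the lower left one; as X^q cancels, evaluating at X = s needs no inverse of s.
module OffDiagonalRescaling {c ℓ} (R : CommutativeRing c ℓ) where
  open Over R
  open CommutativeRing R hiding (Carrier; _≈_; _+_; _*_; -_; 0#; 1#; zero)
  open Polynomial R
  private
    module P = CommutativeRing polyCommutativeRing
    module PO = Over polyCommutativeRing
    module DetP = Determinant polyCommutativeRing
  open Determinant R using (det-cong)
  open BlockPointwise polyCommutativeRing R using (block-pointwise)

  module _ (p q : ℕ) (A : Mat Carrier p p) (B : Mat Carrier p q) (C : Mat Carrier q p) (E : Mat Carrier q q) (s t : Carrier) where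
    private
      ι : ∀ {m n} → Mat Carrier m n → Mat Poly m n
      ι M a b = constP (M a b)

      Y Y′ : Mat Poly (p ℕ.+ q) (p ℕ.+ q)
      Y  = PO.block (ι A) (PO.scaleM Xλ (ι B)) (PO.scaleM (constP t) (ι C)) (ι E)
      Y′ = PO.block (ι A) (ι B) (PO.scaleM (Xλ *P constP t) (ι C)) (ι E)

      d : Fin (p ℕ.+ q) → Poly
      d i = [ const 1P , const Xλ ]′ (splitAt p i)

      d-intertwines : ∀ i j → (d i *P Y i j) ≈P (Y′ i j *P d j)
      d-intertwines i j with splitAt p i | splitAt p j
      ... | inj₁ a | inj₁ b = P.*-comm 1P (constP (A a b))
      ... | inj₁ a | inj₂ b = P.trans (P.*-identityˡ (Xλ *P constP (B a b))) (P.*-comm Xλ (constP (B a b)))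
      ... | inj₂ a | inj₁ b = P.trans (P.sym (P.*-assoc Xλ (constP t) (constP (C a b))))
                                      (P.sym (P.*-identityʳ ((Xλ *P constP t) *P constP (C a b))))
      ... | inj₂ a | inj₂ b = P.*-comm Xλ (constP (E a b))

      prodF-d : ∀ p → DetP.prodF (p ℕ.+ q) (λ i → [ const 1P , const Xλ ]′ (splitAt p i)) ≈P (Xλ ^P q)
      prodF-d zero    = prodF-Xλ q
        where
        prodF-Xλ : ∀ q → DetP.prodF q (const Xλ) ≈P (Xλ ^P q)
        prodF-Xλ zero    = P.refl
        prodF-Xλ (suc q) = P.*-congˡ {Xλ} (prodF-Xλ q)
      prodF-d (suc p) = P.trans (P.*-identityˡ _)
        (P.trans (DetP.prodF-cong (p ℕ.+ q) (λ i → P.reflexive (shift (splitAt p i)))) (prodF-d p))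
        where
        shift : ∀ x → [ const 1P , const Xλ ]′ (Sum.map₁ suc x) ≡ [ const 1P , const Xλ ]′ x
        shift (inj₁ _) = ≡.refl
        shift (inj₂ _) = ≡.refl

      det-d : PO.det (p ℕ.+ q) (DetP.diagonal d) ≈P (Xλ ^P q)
      det-d = P.trans (DetP.det-diagonal (p ℕ.+ q) d) (prodF-d p)

      det-Y≈det-Y′ : PO.det (p ℕ.+ q) Y ≈P PO.det (p ℕ.+ q) Y′
      det-Y≈det-Y′ = Xλ^-*P-cancelˡ q (begin
        (Xλ ^P q) *P PO.det (p ℕ.+ q) Y                           ≈⟨ P.*-congʳ {PO.det (p ℕ.+ q) Y} det-d ⟨
        PO.det (p ℕ.+ q) (DetP.diagonal d) *P PO.det (p ℕ.+ q) Y  ≈⟨ DetP.det-⊛ (p ℕ.+ q) (DetP.diagonal d) Y ⟨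
        PO.det (p ℕ.+ q) (DetP.diagonal d PO.⊛ Y)                 ≈⟨ DetP.det-cong (p ℕ.+ q) (λ i j →
                                                                       P.trans (DetP.diagonal-⊛ d Y i j) (P.trans (d-intertwines i j)
                                                                         (P.sym (DetP.⊛-diagonal d Y′ i j)))) ⟩
        PO.det (p ℕ.+ q) (Y′ PO.⊛ DetP.diagonal d)                ≈⟨ DetP.det-⊛ (p ℕ.+ q) Y′ (DetP.diagonal d) ⟩
        PO.det (p ℕ.+ q) Y′ *P PO.det (p ℕ.+ q) (DetP.diagonal d) ≈⟨ P.*-congˡ {PO.det (p ℕ.+ q) Y′} det-d ⟩
        PO.det (p ℕ.+ q) Y′ *P (Xλ ^P q)                          ≈⟨ P.*-comm (PO.det (p ℕ.+ q) Y′) (Xλ ^P q) ⟩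
        (Xλ ^P q) *P PO.det (p ℕ.+ q) Y′                          ∎)
        where open ≈-Reasoning P.setoid

      eval-Y : ∀ i j → eval s (Y i j) ≈ block A (scaleM s B) (scaleM t C) E i j
      eval-Y = block-pointwise (λ x y → eval s x ≈ y)
        {A = ι A} {PO.scaleM Xλ (ι B)} {PO.scaleM (constP t) (ι C)} {ι E} {A} {scaleM s B} {scaleM t C} {E}
        (λ a b → eval-constP s _)
        (λ a b → trans (eval-*P s Xλ (constP (B a b))) (*-cong (eval-Xλ s) (eval-constP s (B a b))))
        (λ a b → trans (eval-*P s (constP t) (constP (C a b))) (*-cong (eval-constP s t) (eval-constP s (C a b))))
        (λ a b → eval-constP s _)

      eval-Y′ : ∀ i j → eval s (Y′ i j) ≈ block A B (scaleM (s * t) C) E i j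
      eval-Y′ = block-pointwise (λ x y → eval s x ≈ y)
        {A = ι A} {ι B} {PO.scaleM (Xλ *P constP t) (ι C)} {ι E} {A} {B} {scaleM (s * t) C} {E}
        (λ a b → eval-constP s _)
        (λ a b → eval-constP s _)
        (λ a b → trans (eval-*P s (Xλ *P constP t) (constP (C a b)))
                   (*-cong (trans (eval-*P s Xλ (constP t)) (*-cong (eval-Xλ s) (eval-constP s t))) (eval-constP s (C a b))))
        (λ a b → eval-constP s _)

    open RingHomomorphism polyCommutativeRing R (eval-isRingHomomorphism s) using () renaming (det-homo to eval-det)

    det-rescaleOffDiagonal :
      det (p ℕ.+ q) (block A (scaleM s B) (scaleM t C) E) ≈ det (p ℕ.+ q) (block A B (scaleM (s * t) C) E)
    det-rescaleOffDiagonal = begin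
      det (p ℕ.+ q) (block A (scaleM s B) (scaleM t C) E)   ≈⟨ det-cong (p ℕ.+ q) eval-Y ⟨
      det (p ℕ.+ q) (λ i j → eval s (Y i j))                ≈⟨ eval-det (p ℕ.+ q) Y ⟨
      eval s (PO.det (p ℕ.+ q) Y)                           ≈⟨ eval-cong s det-Y≈det-Y′ ⟩
      eval s (PO.det (p ℕ.+ q) Y′)                          ≈⟨ eval-det (p ℕ.+ q) Y′ ⟩
      det (p ℕ.+ q) (λ i j → eval s (Y′ i j))               ≈⟨ det-cong (p ℕ.+ q) eval-Y′ ⟩
      det (p ℕ.+ q) (block A B (scaleM (s * t) C) E)        ∎
      where open ≈-Reasoning setoid

module CharacteristicPolynomial {c ℓ} (K : CommutativeRing c ℓ) where
  open import Data.List using ([])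
  open Over K
  open CommutativeRing K hiding (Carrier; _≈_; _+_; _*_; -_; 0#; 1#; zero)
  open RingProperties ring using (-0#≈0#; -‿distribʳ-*)
  open Polynomial K
  open FinSplit
  private
    module P = CommutativeRing polyCommutativeRing
    module PO = Over polyCommutativeRing
    module DetP = Determinant polyCommutativeRing
    module MatrixP = MatrixAlgebra polyCommutativeRing
    module BlockK = BlockMatrix K
    module BlockP = BlockMatrix polyCommutativeRing
    module constP = RingHomomorphism K polyCommutativeRing constP-isRingHomomorphism
  open Kronecker K using (kron-↑ˡ-↑ˡ; kron-↑ʳ-↑ˡ; kron-↑ʳ-↑ʳ; kron-cong)
  open MatrixAlgebra K using (Id-suc)
  open IsRingHomomorphism constP-isRingHomomorphism using () renaming (⟦⟧-cong to constP-cong; *-homo to constP-*-homo)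

  charMatrix : ∀ {n} → Mat Carrier n n → Mat Poly n n
  charMatrix M i j = (if ⌊ i Fin.≟ j ⌋ then Xλ else 0P) +P negP (constP (M i j))

  negConstM : ∀ {m n} → Mat Carrier m n → Mat Poly m n
  negConstM B a b = negP (constP (B a b))

  charPoly-cong : ∀ {n} {M M′ : Mat Carrier n n} → M ≈M M′ → charPoly M ≈P charPoly M′
  charPoly-cong {n} e = DetP.det-cong n (λ i j → +P-cong ≈P-refl (negP-cong (constP-cong (e i j))))

  charMatrix-block : ∀ {p q} (A : Mat Carrier p p) (B : Mat Carrier p q) (C : Mat Carrier q p) (D : Mat Carrier q q) →
    charMatrix (block A B C D) PO.≈M PO.block (charMatrix A) (negConstM B) (negConstM C) (charMatrix D)
  charMatrix-block {p} {q} A B C D i j with view p q i | view p q j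
  ... | left a  | left b  rewrite BlockK.block-↑ˡ-↑ˡ A B C D a b
                                | BlockP.block-↑ˡ-↑ˡ (charMatrix A) (negConstM B) (negConstM C) (charMatrix D) a b
                                | ⌊≟⌋-injective (_↑ˡ q) (↑ˡ-injective q _ _) a b = ≈P-refl
  ... | left a  | right b rewrite BlockK.block-↑ˡ-↑ʳ A B C D a b
                                | BlockP.block-↑ˡ-↑ʳ (charMatrix A) (negConstM B) (negConstM C) (charMatrix D) a b
                                | ⌊≟⌋-≢ (↑ˡ≢↑ʳ a b) = ≈P-refl
  ... | right a | left b  rewrite BlockK.block-↑ʳ-↑ˡ A B C D a b
                                | BlockP.block-↑ʳ-↑ˡ (charMatrix A) (negConstM B) (negConstM C) (charMatrix D) a b
                                | ⌊≟⌋-≢ (↑ˡ≢↑ʳ b a ∘ ≡.sym) = ≈P-refl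
  ... | right a | right b rewrite BlockK.block-↑ʳ-↑ʳ A B C D a b
                                | BlockP.block-↑ʳ-↑ʳ (charMatrix A) (negConstM B) (negConstM C) (charMatrix D) a b
                                | ⌊≟⌋-injective (p ↑ʳ_) (↑ʳ-injective p _ _) a b = ≈P-refl

  charPoly-reindex : ∀ {m n} → m ≡ n → (π : Fin m → Fin n) → (∀ {a b} → π a ≡ π b → a ≡ b) → (M : Mat Carrier n n) →
    charPoly (λ i j → M (π i) (π j)) ≈P charPoly M
  charPoly-reindex {n = n} ≡.refl π π-inj M = P.trans (DetP.det-cong n reindex) (DetP.det-permute n π π-inj (charMatrix M))
    where
    reindex : ∀ i j → charMatrix (λ i j → M (π i) (π j)) i j ≈P charMatrix M (π i) (π j)
    reindex i j rewrite ⌊≟⌋-injective π π-inj i j = ≈P-refl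

  charPoly-blockUpperTriangular : ∀ p q (M : Mat Carrier (p ℕ.+ q) (p ℕ.+ q)) → (∀ i j → M (p ↑ʳ i) (j ↑ˡ q) ≈ 0#) →
    charPoly M ≈P (charPoly (λ i j → M (i ↑ˡ q) (j ↑ˡ q)) *P charPoly (λ i j → M (p ↑ʳ i) (p ↑ʳ j)))
  charPoly-blockUpperTriangular p q M h =
    P.trans (DetP.det-blockUpperTriangular p q (charMatrix M) lower-left) (P.*-cong (DetP.det-cong p upper-left) (DetP.det-cong q lower-right))
    where
    lower-left : ∀ i j → charMatrix M (p ↑ʳ i) (j ↑ˡ q) ≈P []
    lower-left i j rewrite ⌊≟⌋-≢ (↑ˡ≢↑ʳ j i ∘ ≡.sym) = nilʳ (trans (-‿cong (h i j)) -0#≈0#) nil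
    upper-left : ∀ i j → charMatrix M (i ↑ˡ q) (j ↑ˡ q) ≈P charMatrix (λ i j → M (i ↑ˡ q) (j ↑ˡ q)) i j
    upper-left i j rewrite ⌊≟⌋-injective (_↑ˡ q) (↑ˡ-injective q _ _) i j = ≈P-refl
    lower-right : ∀ i j → charMatrix M (p ↑ʳ i) (p ↑ʳ j) ≈P charMatrix (λ i j → M (p ↑ʳ i) (p ↑ʳ j)) i j
    lower-right i j rewrite ⌊≟⌋-injective (p ↑ʳ_) (↑ʳ-injective p _ _) i j = ≈P-refl

  charPoly-blockTriangular : ∀ {p q} (A : Mat Carrier p p) (B : Mat Carrier p q) (C : Mat Carrier q p) (D : Mat Carrier q q) →
    (∀ i j → C i j ≈ 0#) → charPoly (block A B C D) ≈P (charPoly A *P charPoly D)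
  charPoly-blockTriangular {p} {q} A B C D C≈0 =
    P.trans (charPoly-blockUpperTriangular p q (block A B C D) (λ i j → trans (reflexive (BlockK.block-↑ʳ-↑ˡ A B C D i j)) (C≈0 i j)))
      (P.*-cong (charPoly-cong (λ i j → reflexive (BlockK.block-↑ˡ-↑ˡ A B C D i j)))
                (charPoly-cong (λ i j → reflexive (BlockK.block-↑ʳ-↑ʳ A B C D i j))))

  charPoly-Id⊗ : ∀ {v} (A : Mat Carrier v v) u → charPoly (kron (Id u) A) ≈P (charPoly A ^P u)
  charPoly-Id⊗ A zero = ≈P-refl
  charPoly-Id⊗ {v} A (suc u) = P.trans
    (charPoly-blockUpperTriangular v (u ℕ.* v) (kron (Id (suc u)) A)
      (λ i j → trans (reflexive (kron-↑ʳ-↑ˡ (Id (suc u)) A i j)) (zeroˡ _)))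
    (P.*-cong (charPoly-cong (λ i j → trans (reflexive (kron-↑ˡ-↑ˡ (Id (suc u)) A i j)) (*-identityˡ _)))
              (P.trans (charPoly-cong (λ i j → trans (reflexive (kron-↑ʳ-↑ʳ (Id (suc u)) A i j))
                                                     (kron-cong {B = A} Id-suc (λ _ _ → refl) i j)))
                       (charPoly-Id⊗ A u)))

  charPoly-rescaleOffDiagonal : ∀ {p q} (A : Mat Carrier p p) (B : Mat Carrier p q) (C : Mat Carrier q p) (E : Mat Carrier q q) s t →
    charPoly (block A (scaleM s B) (scaleM t C) E) ≈P charPoly (block A B (scaleM (s * t) C) E)
  charPoly-rescaleOffDiagonal {p} {q} A B C E s t = begin
    charPoly (block A (scaleM s B) (scaleM t C) E)
      ≈⟨ DetP.det-cong (p ℕ.+ q) (λ i j → P.trans (charMatrix-block A (scaleM s B) (scaleM t C) E i j)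
           (BlockP.block-cong {A = charMatrix A} (λ _ _ → P.refl) (negConstM-scaleM s B) (negConstM-scaleM t C) (λ _ _ → P.refl) i j)) ⟩
    PO.det (p ℕ.+ q) (PO.block (charMatrix A) (PO.scaleM (constP s) (negConstM B)) (PO.scaleM (constP t) (negConstM C)) (charMatrix E))
      ≈⟨ OffDiagonalRescaling.det-rescaleOffDiagonal polyCommutativeRing p q
           (charMatrix A) (negConstM B) (negConstM C) (charMatrix E) (constP s) (constP t) ⟩
    PO.det (p ℕ.+ q) (PO.block (charMatrix A) (negConstM B) (PO.scaleM (constP s *P constP t) (negConstM C)) (charMatrix E))
      ≈⟨ DetP.det-cong (p ℕ.+ q) (λ i j → P.trans
           (BlockP.block-cong {A = charMatrix A} (λ _ _ → P.refl) (λ _ _ → P.refl) rescale-st (λ _ _ → P.refl) i j)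
           (P.sym (charMatrix-block A B (scaleM (s * t) C) E i j))) ⟩
    charPoly (block A B (scaleM (s * t) C) E) ∎
    where
    open ≈-Reasoning P.setoid
    negConstM-scaleM : ∀ {m n} x (N : Mat Carrier m n) → ∀ a b → negConstM (scaleM x N) a b ≈P (constP x *P negConstM N a b)
    negConstM-scaleM x N a b = P.trans (constP-cong (-‿distribʳ-* x (N a b))) (constP-*-homo x (- N a b))
    rescale-st : ∀ a b → ((constP s *P constP t) *P negConstM C a b) ≈P negConstM (scaleM (s * t) C) a b
    rescale-st a b = P.trans (P.*-congʳ {negConstM C a b} (P.sym (constP-*-homo s t))) (P.sym (negConstM-scaleM (s * t) C a b))

  charPoly-conjugate : ∀ n (W W′ M : Mat Carrier n n) → (W ⊛ W′) ≈M Id n → charPoly ((W ⊛ M) ⊛ W′) ≈P charPoly M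
  charPoly-conjugate n W W′ M WW′≈I = begin
    charPoly ((W ⊛ M) ⊛ W′)
      ≈⟨ DetP.det-cong n (λ i j → P.trans (scalarMinus ((W ⊛ M) ⊛ W′) i j)
                                         (+P-cong ≈P-refl (negP-cong (conjugate-const i j)))) ⟩
    PO.det n (λ i j → (Xλ *P PO.Id n i j) +P negP (((ι W PO.⊛ ι M) PO.⊛ ι W′) i j))
      ≈⟨ DetP.det-cong n (λ i j → P.sym (DetP.conjugate-scalarMinus n (ι W) (ι W′) (ι M) Xλ ιWW′≈I i j)) ⟩
    PO.det n ((ι W PO.⊛ (λ i j → (Xλ *P PO.Id n i j) +P negP (ι M i j))) PO.⊛ ι W′)
      ≈⟨ DetP.det-conjugate n (ι W) (ι W′) _ ιWW′≈I ⟩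
    PO.det n (λ i j → (Xλ *P PO.Id n i j) +P negP (ι M i j))
      ≈⟨ DetP.det-cong n (λ i j → P.sym (scalarMinus M i j)) ⟩
    charPoly M ∎
    where
    open ≈-Reasoning P.setoid
    ι : Mat Carrier n n → Mat Poly n n
    ι N a b = constP (N a b)
    constP-Id : ∀ i j → constP (Id n i j) ≈P PO.Id n i j
    constP-Id i j with ⌊ i Fin.≟ j ⌋
    ... | true  = ≈P-refl
    ... | false = nilʳ refl nil
    ιWW′≈I : (ι W PO.⊛ ι W′) PO.≈M PO.Id n
    ιWW′≈I i j = P.trans (P.sym (constP.⊛-homo W W′ i j)) (P.trans (constP-cong (WW′≈I i j)) (constP-Id i j))
    conjugate-const : ∀ i j → constP (((W ⊛ M) ⊛ W′) i j) ≈P ((ι W PO.⊛ ι M) PO.⊛ ι W′) i j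
    conjugate-const i j = P.trans (constP.⊛-homo (W ⊛ M) W′ i j)
      (MatrixP.⊛-cong {A = λ a b → constP ((W ⊛ M) a b)} {B = ι W′} (constP.⊛-homo W M) (λ _ _ → ≈P-refl) i j)
    scalarMinus : ∀ (N : Mat Carrier n n) i j → charMatrix N i j ≈P ((Xλ *P PO.Id n i j) +P negP (constP (N i j)))
    scalarMinus N i j with ⌊ i Fin.≟ j ⌋
    ... | true  = +P-cong (P.sym (P.*-identityʳ Xλ)) (≈P-refl {negP (constP (N i j))})
    ... | false = +P-cong (P.sym (P.zeroʳ Xλ)) (≈P-refl {negP (constP (N i j))})

module MiddleInterchange where
  open FinSplit

  swapMiddle : ∀ A B C D → Fin ((A ℕ.+ B) ℕ.+ (C ℕ.+ D)) → Fin ((A ℕ.+ C) ℕ.+ (B ℕ.+ D))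
  swapMiddle A B C D i with splitAt (A ℕ.+ B) i
  ... | inj₁ x with splitAt A x
  ...   | inj₁ a = (a ↑ˡ C) ↑ˡ (B ℕ.+ D)
  ...   | inj₂ b = (A ℕ.+ C) ↑ʳ (b ↑ˡ D)
  swapMiddle A B C D i | inj₂ y with splitAt C y
  ...   | inj₁ c = (A ↑ʳ c) ↑ˡ (B ℕ.+ D)
  ...   | inj₂ d = (A ℕ.+ C) ↑ʳ (B ↑ʳ d)

  module _ (A B C D : ℕ) where
    swapMiddle-₁ : ∀ a → swapMiddle A B C D ((a ↑ˡ B) ↑ˡ (C ℕ.+ D)) ≡ (a ↑ˡ C) ↑ˡ (B ℕ.+ D)
    swapMiddle-₁ a rewrite splitAt-↑ˡ (A ℕ.+ B) (a ↑ˡ B) (C ℕ.+ D) | splitAt-↑ˡ A a B = ≡.refl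
    swapMiddle-₂ : ∀ b → swapMiddle A B C D ((A ↑ʳ b) ↑ˡ (C ℕ.+ D)) ≡ (A ℕ.+ C) ↑ʳ (b ↑ˡ D)
    swapMiddle-₂ b rewrite splitAt-↑ˡ (A ℕ.+ B) (A ↑ʳ b) (C ℕ.+ D) | splitAt-↑ʳ A B b = ≡.refl
    swapMiddle-₃ : ∀ c → swapMiddle A B C D ((A ℕ.+ B) ↑ʳ (c ↑ˡ D)) ≡ (A ↑ʳ c) ↑ˡ (B ℕ.+ D)
    swapMiddle-₃ c rewrite splitAt-↑ʳ (A ℕ.+ B) (C ℕ.+ D) (c ↑ˡ D) | splitAt-↑ˡ C c D = ≡.refl
    swapMiddle-₄ : ∀ d → swapMiddle A B C D ((A ℕ.+ B) ↑ʳ (C ↑ʳ d)) ≡ (A ℕ.+ C) ↑ʳ (B ↑ʳ d)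
    swapMiddle-₄ d rewrite splitAt-↑ʳ (A ℕ.+ B) (C ℕ.+ D) (C ↑ʳ d) | splitAt-↑ʳ C D d = ≡.refl

  swapMiddle-involutive : ∀ A B C D i → swapMiddle A C B D (swapMiddle A B C D i) ≡ i
  swapMiddle-involutive A B C D i with view (A ℕ.+ B) (C ℕ.+ D) i
  ... | left x with view A B x
  ...   | left a  rewrite swapMiddle-₁ A B C D a = swapMiddle-₁ A C B D a
  ...   | right b rewrite swapMiddle-₂ A B C D b = swapMiddle-₃ A C B D b
  swapMiddle-involutive A B C D i | right y with view C D y
  ...   | left c  rewrite swapMiddle-₃ A B C D c = swapMiddle-₂ A C B D c
  ...   | right d rewrite swapMiddle-₄ A B C D d = swapMiddle-₄ A C B D d

  swapMiddle-injective : ∀ A B C D {i j} → swapMiddle A B C D i ≡ swapMiddle A B C D j → i ≡ j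
  swapMiddle-injective A B C D {i} {j} e =
    ≡.trans (≡.sym (swapMiddle-involutive A B C D i))
      (≡.trans (≡.cong (swapMiddle A C B D) e) (swapMiddle-involutive A B C D j))

module PartitionedTensorProduct {c ℓ} (K : CommutativeRing c ℓ) {v₀ v₁ : ℕ}
  (H₀₀ : Mat (CommutativeRing.Carrier K) v₀ v₀) (H₀₁ : Mat (CommutativeRing.Carrier K) v₀ v₁)
  (H₁₀ : Mat (CommutativeRing.Carrier K) v₁ v₀) (H₁₁ : Mat (CommutativeRing.Carrier K) v₁ v₁) where
  open Over K
  open CommutativeRing K hiding (Carrier; _≈_; _+_; _*_; -_; 0#; 1#; zero)
  open Polynomial K
  open MatrixAlgebra K
  open FinSplit
  open BlockMatrix K
  open Kronecker K
  open CharacteristicPolynomial K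
  open MiddleInterchange
  private
    module P = CommutativeRing polyCommutativeRing

  -- Over the blocks toR Hᵢⱼ, ptp G₀₁ G₁₀ … is definitionally partitionedTensor (toR G₀₁) (toR G₁₀),
  -- and H ↑ σ is scaledH σ σ.
  partitionedTensor : ∀ {u₀ u₁} → Mat Carrier u₀ u₁ → Mat Carrier u₁ u₀ →
    Mat Carrier (u₀ ℕ.* v₀ ℕ.+ u₁ ℕ.* v₁) (u₀ ℕ.* v₀ ℕ.+ u₁ ℕ.* v₁)
  partitionedTensor {u₀} {u₁} S T = block (kron (Id u₀) H₀₀) (kron S H₀₁) (kron T H₁₀) (kron (Id u₁) H₁₁)

  scaledH : Carrier → Carrier → Mat Carrier (v₀ ℕ.+ v₁) (v₀ ℕ.+ v₁)
  scaledH s t = block H₀₀ (scaleM s H₀₁) (scaleM t H₁₀) H₁₁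

  charPoly-scaledH : ∀ s t σ → ((σ ≈ s) × (σ ≈ t)) ⊎ ((σ ≈ 0#) × (s * t ≈ 0#)) →
    charPoly (scaledH s t) ≈P charPoly (scaledH σ σ)
  charPoly-scaledH s t σ (inj₁ (σ≈s , σ≈t)) = charPoly-cong
    (block-cong {A = H₀₀} (λ _ _ → refl) (λ _ _ → *-congʳ (sym σ≈s)) (λ _ _ → *-congʳ (sym σ≈t)) (λ _ _ → refl))
  charPoly-scaledH s t σ (inj₂ (σ≈0 , st≈0)) = begin
    charPoly (scaledH s t)
      ≈⟨ charPoly-rescaleOffDiagonal H₀₀ H₀₁ H₁₀ H₁₁ s t ⟩
    charPoly (block H₀₀ H₀₁ (scaleM (s * t) H₁₀) H₁₁)
      ≈⟨ charPoly-cong (block-cong {A = H₀₀} (λ _ _ → refl) (λ _ _ → refl) (λ _ _ → *-congʳ st≈σσ) (λ _ _ → refl)) ⟩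
    charPoly (block H₀₀ H₀₁ (scaleM (σ * σ) H₁₀) H₁₁)
      ≈⟨ charPoly-rescaleOffDiagonal H₀₀ H₀₁ H₁₀ H₁₁ σ σ ⟨
    charPoly (scaledH σ σ) ∎
    where
    open ≈-Reasoning P.setoid
    st≈σσ : s * t ≈ σ * σ
    st≈σσ = trans st≈0 (sym (trans (*-congˡ σ≈0) (zeroʳ σ)))

  dropFirst : ∀ {m n} → Mat Carrier (suc m) (suc n) → Mat Carrier m n
  dropFirst S i j = S (suc i) (suc j)

  module FirstVertices (a b : ℕ) (S : Mat Carrier (suc a) (suc b)) (T : Mat Carrier (suc b) (suc a)) where
    p q : ℕ
    p = v₀ ℕ.+ v₁
    q = a ℕ.* v₀ ℕ.+ b ℕ.* v₁

    π : Fin (p ℕ.+ q) → Fin (suc a ℕ.* v₀ ℕ.+ suc b ℕ.* v₁)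
    π = swapMiddle v₀ v₁ (a ℕ.* v₀) (b ℕ.* v₁)

    π-injective : ∀ {i j} → π i ≡ π j → i ≡ j
    π-injective = swapMiddle-injective v₀ v₁ (a ℕ.* v₀) (b ℕ.* v₁)

    M′ : Mat Carrier (p ℕ.+ q) (p ℕ.+ q)
    M′ i j = partitionedTensor S T (π i) (π j)

    private
      X₀₀ : Mat Carrier (suc a ℕ.* v₀) (suc a ℕ.* v₀)
      X₀₀ = kron (Id (suc a)) H₀₀
      X₀₁ : Mat Carrier (suc a ℕ.* v₀) (suc b ℕ.* v₁)
      X₀₁ = kron S H₀₁
      X₁₀ : Mat Carrier (suc b ℕ.* v₁) (suc a ℕ.* v₀)
      X₁₀ = kron T H₁₀
      X₁₁ : Mat Carrier (suc b ℕ.* v₁) (suc b ℕ.* v₁)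
      X₁₁ = kron (Id (suc b)) H₁₁
      Y₀₀ : Mat Carrier (a ℕ.* v₀) (a ℕ.* v₀)
      Y₀₀ = kron (Id a) H₀₀
      Y₀₁ : Mat Carrier (a ℕ.* v₀) (b ℕ.* v₁)
      Y₀₁ = kron (dropFirst S) H₀₁
      Y₁₀ : Mat Carrier (b ℕ.* v₁) (a ℕ.* v₀)
      Y₁₀ = kron (dropFirst T) H₁₀
      Y₁₁ : Mat Carrier (b ℕ.* v₁) (b ℕ.* v₁)
      Y₁₁ = kron (Id b) H₁₁
      π₁ : ∀ x → π ((x ↑ˡ v₁) ↑ˡ q) ≡ (x ↑ˡ (a ℕ.* v₀)) ↑ˡ (v₁ ℕ.+ b ℕ.* v₁)
      π₁ = swapMiddle-₁ v₀ v₁ (a ℕ.* v₀) (b ℕ.* v₁)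
      π₂ : ∀ y → π ((v₀ ↑ʳ y) ↑ˡ q) ≡ (v₀ ℕ.+ a ℕ.* v₀) ↑ʳ (y ↑ˡ (b ℕ.* v₁))
      π₂ = swapMiddle-₂ v₀ v₁ (a ℕ.* v₀) (b ℕ.* v₁)
      π₃ : ∀ x → π (p ↑ʳ (x ↑ˡ (b ℕ.* v₁))) ≡ (v₀ ↑ʳ x) ↑ˡ (v₁ ℕ.+ b ℕ.* v₁)
      π₃ = swapMiddle-₃ v₀ v₁ (a ℕ.* v₀) (b ℕ.* v₁)
      π₄ : ∀ y → π (p ↑ʳ ((a ℕ.* v₀) ↑ʳ y)) ≡ (v₀ ℕ.+ a ℕ.* v₀) ↑ʳ (v₁ ↑ʳ y)
      π₄ = swapMiddle-₄ v₀ v₁ (a ℕ.* v₀) (b ℕ.* v₁)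

    M′-lowerLeft : UpperTri S → UpperTri T → ∀ i j → M′ (p ↑ʳ i) (j ↑ˡ q) ≈ 0#
    M′-lowerLeft S-upper T-upper i j with view (a ℕ.* v₀) (b ℕ.* v₁) i | view v₀ v₁ j
    ... | left x  | left y  rewrite π₃ x | π₁ y
                                  | block-↑ˡ-↑ˡ X₀₀ X₀₁ X₁₀ X₁₁ (v₀ ↑ʳ x) (y ↑ˡ (a ℕ.* v₀))
                                  | kron-↑ʳ-↑ˡ (Id (suc a)) H₀₀ x y = zeroˡ _
    ... | left x  | right y rewrite π₃ x | π₂ y
                                  | block-↑ˡ-↑ʳ X₀₀ X₀₁ X₁₀ X₁₁ (v₀ ↑ʳ x) (y ↑ˡ (b ℕ.* v₁))
                                  | kron-↑ʳ-↑ˡ S H₀₁ x y = trans (*-congʳ (S-upper _ zero (ℕ.s≤s ℕ.z≤n))) (zeroˡ _)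
    ... | right x | left y  rewrite π₄ x | π₁ y
                                  | block-↑ʳ-↑ˡ X₀₀ X₀₁ X₁₀ X₁₁ (v₁ ↑ʳ x) (y ↑ˡ (a ℕ.* v₀))
                                  | kron-↑ʳ-↑ˡ T H₁₀ x y = trans (*-congʳ (T-upper _ zero (ℕ.s≤s ℕ.z≤n))) (zeroˡ _)
    ... | right x | right y rewrite π₄ x | π₂ y
                                  | block-↑ʳ-↑ʳ X₀₀ X₀₁ X₁₀ X₁₁ (v₁ ↑ʳ x) (y ↑ˡ (b ℕ.* v₁))
                                  | kron-↑ʳ-↑ˡ (Id (suc b)) H₁₁ x y = zeroˡ _

    M′-upperLeft : ∀ i j → M′ (i ↑ˡ q) (j ↑ˡ q) ≈ scaledH (S zero zero) (T zero zero) i j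
    M′-upperLeft i j with view v₀ v₁ i | view v₀ v₁ j
    ... | left x  | left y  rewrite π₁ x | π₁ y
                                  | block-↑ˡ-↑ˡ X₀₀ X₀₁ X₁₀ X₁₁ (x ↑ˡ (a ℕ.* v₀)) (y ↑ˡ (a ℕ.* v₀))
                                  | kron-↑ˡ-↑ˡ (Id (suc a)) H₀₀ x y
                                  | block-↑ˡ-↑ˡ H₀₀ (scaleM (S zero zero) H₀₁) (scaleM (T zero zero) H₁₀) H₁₁ x y = *-identityˡ _
    ... | left x  | right y rewrite π₁ x | π₂ y
                                  | block-↑ˡ-↑ʳ X₀₀ X₀₁ X₁₀ X₁₁ (x ↑ˡ (a ℕ.* v₀)) (y ↑ˡ (b ℕ.* v₁))
                                  | kron-↑ˡ-↑ˡ S H₀₁ x y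
                                  | block-↑ˡ-↑ʳ H₀₀ (scaleM (S zero zero) H₀₁) (scaleM (T zero zero) H₁₀) H₁₁ x y = refl
    ... | right x | left y  rewrite π₂ x | π₁ y
                                  | block-↑ʳ-↑ˡ X₀₀ X₀₁ X₁₀ X₁₁ (x ↑ˡ (b ℕ.* v₁)) (y ↑ˡ (a ℕ.* v₀))
                                  | kron-↑ˡ-↑ˡ T H₁₀ x y
                                  | block-↑ʳ-↑ˡ H₀₀ (scaleM (S zero zero) H₀₁) (scaleM (T zero zero) H₁₀) H₁₁ x y = refl
    ... | right x | right y rewrite π₂ x | π₂ y
                                  | block-↑ʳ-↑ʳ X₀₀ X₀₁ X₁₀ X₁₁ (x ↑ˡ (b ℕ.* v₁)) (y ↑ˡ (b ℕ.* v₁))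
                                  | kron-↑ˡ-↑ˡ (Id (suc b)) H₁₁ x y
                                  | block-↑ʳ-↑ʳ H₀₀ (scaleM (S zero zero) H₀₁) (scaleM (T zero zero) H₁₀) H₁₁ x y = *-identityˡ _

    M′-lowerRight : ∀ i j → M′ (p ↑ʳ i) (p ↑ʳ j) ≈ partitionedTensor (dropFirst S) (dropFirst T) i j
    M′-lowerRight i j with view (a ℕ.* v₀) (b ℕ.* v₁) i | view (a ℕ.* v₀) (b ℕ.* v₁) j
    ... | left x  | left y  rewrite π₃ x | π₃ y
                                  | block-↑ˡ-↑ˡ X₀₀ X₀₁ X₁₀ X₁₁ (v₀ ↑ʳ x) (v₀ ↑ʳ y)
                                  | kron-↑ʳ-↑ʳ (Id (suc a)) H₀₀ x y
                                  | block-↑ˡ-↑ˡ Y₀₀ Y₀₁ Y₁₀ Y₁₁ x y = *-congʳ (Id-suc (quotient {a} v₀ x) (quotient {a} v₀ y))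
    ... | left x  | right y rewrite π₃ x | π₄ y
                                  | block-↑ˡ-↑ʳ X₀₀ X₀₁ X₁₀ X₁₁ (v₀ ↑ʳ x) (v₁ ↑ʳ y)
                                  | kron-↑ʳ-↑ʳ S H₀₁ x y
                                  | block-↑ˡ-↑ʳ Y₀₀ Y₀₁ Y₁₀ Y₁₁ x y = refl
    ... | right x | left y  rewrite π₄ x | π₃ y
                                  | block-↑ʳ-↑ˡ X₀₀ X₀₁ X₁₀ X₁₁ (v₁ ↑ʳ x) (v₀ ↑ʳ y)
                                  | kron-↑ʳ-↑ʳ T H₁₀ x y
                                  | block-↑ʳ-↑ˡ Y₀₀ Y₀₁ Y₁₀ Y₁₁ x y = refl
    ... | right x | right y rewrite π₄ x | π₄ y
                                  | block-↑ʳ-↑ʳ X₀₀ X₀₁ X₁₀ X₁₁ (v₁ ↑ʳ x) (v₁ ↑ʳ y)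
                                  | kron-↑ʳ-↑ʳ (Id (suc b)) H₁₁ x y
                                  | block-↑ʳ-↑ʳ Y₀₀ Y₀₁ Y₁₀ Y₁₁ x y = *-congʳ (Id-suc (quotient {b} v₁ x) (quotient {b} v₁ y))

  charPoly-peel : ∀ a b (S : Mat Carrier (suc a) (suc b)) (T : Mat Carrier (suc b) (suc a)) → UpperTri S → UpperTri T →
    charPoly (partitionedTensor S T)
      ≈P (charPoly (scaledH (S zero zero) (T zero zero)) *P charPoly (partitionedTensor (dropFirst S) (dropFirst T)))
  charPoly-peel a b S T S-upper T-upper = begin
    charPoly (partitionedTensor S T)
      ≈⟨ charPoly-reindex (+-interchange v₀ v₁ (a ℕ.* v₀) (b ℕ.* v₁)) π π-injective (partitionedTensor S T) ⟨
    charPoly {p ℕ.+ q} M′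
      ≈⟨ charPoly-blockUpperTriangular p q M′ (M′-lowerLeft S-upper T-upper) ⟩
    charPoly {p} (λ i j → M′ (i ↑ˡ q) (j ↑ˡ q)) *P charPoly {q} (λ i j → M′ (p ↑ʳ i) (p ↑ʳ j))
      ≈⟨ P.*-cong (charPoly-cong M′-upperLeft) (charPoly-cong M′-lowerRight) ⟩
    charPoly (scaledH (S zero zero) (T zero zero)) *P charPoly (partitionedTensor (dropFirst S) (dropFirst T)) ∎
    where
    open ≈-Reasoning P.setoid
    open FirstVertices a b S T

  excess : ℕ → ℕ → Poly
  excess u₀ u₁ = (charPoly H₀₀ ^P (u₀ ∸ u₁)) *P (charPoly H₁₁ ^P (u₁ ∸ u₀))

  excess-≥ : ∀ {u₀ u₁} → u₁ ≤ u₀ → excess u₀ u₁ ≈P (charPoly H₀₀ ^P (u₀ ∸ u₁))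
  excess-≥ u₁≤u₀ rewrite ℕ.m≤n⇒m∸n≡0 u₁≤u₀ = P.*-identityʳ _

  excess-≤ : ∀ {u₀ u₁} → u₀ ≤ u₁ → excess u₀ u₁ ≈P (charPoly H₁₁ ^P (u₁ ∸ u₀))
  excess-≤ u₀≤u₁ rewrite ℕ.m≤n⇒m∸n≡0 u₀≤u₁ = P.*-identityˡ _

  Admissible : ∀ {u₀ u₁} → Mat Carrier u₀ u₁ → Mat Carrier u₁ u₀ → (Fin (u₀ ⊓ u₁) → Carrier) → Set ℓ
  Admissible S T σ = ∀ j → ((σ j ≈ diagEntry S j) × (σ j ≈ diagEntry′ T j))
                         ⊎ ((σ j ≈ 0#) × ((diagEntry S j * diagEntry′ T j) ≈ 0#))

  charPoly-partitionedTensor-upperTriangular : ∀ u₀ u₁ (S : Mat Carrier u₀ u₁) (T : Mat Carrier u₁ u₀) →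
    UpperTri S → UpperTri T → (σ : Fin (u₀ ⊓ u₁) → Carrier) → Admissible S T σ →
    charPoly (partitionedTensor S T) ≈P (prodP (u₀ ⊓ u₁) (λ j → charPoly (scaledH (σ j) (σ j))) *P excess u₀ u₁)
  charPoly-partitionedTensor-upperTriangular zero u₁ S T _ _ σ _ rewrite ℕ.0∸n≡0 u₁ = begin
    charPoly (partitionedTensor S T)                ≈⟨ charPoly-blockTriangular (kron (Id 0) H₀₀) (kron S H₀₁) (kron T H₁₀) (kron (Id u₁) H₁₁) (λ i ()) ⟩
    1P *P charPoly (kron (Id u₁) H₁₁)               ≈⟨ P.*-congˡ {1P} (charPoly-Id⊗ H₁₁ u₁) ⟩
    1P *P (charPoly H₁₁ ^P u₁)                      ≈⟨ P.*-congˡ {1P} (P.*-identityˡ (charPoly H₁₁ ^P u₁)) ⟨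
    1P *P (1P *P (charPoly H₁₁ ^P u₁))              ∎
    where open ≈-Reasoning P.setoid
  charPoly-partitionedTensor-upperTriangular (suc a) zero S T _ _ σ _ = begin
    charPoly (partitionedTensor S T)                ≈⟨ charPoly-blockTriangular (kron (Id (suc a)) H₀₀) (kron S H₀₁) (kron T H₁₀) (kron (Id 0) H₁₁) (λ ()) ⟩
    charPoly (kron (Id (suc a)) H₀₀) *P 1P          ≈⟨ P.*-congʳ {1P} (charPoly-Id⊗ H₀₀ (suc a)) ⟩
    (charPoly H₀₀ ^P suc a) *P 1P                   ≈⟨ P.*-identityˡ _ ⟨
    1P *P ((charPoly H₀₀ ^P suc a) *P 1P)           ∎
    where open ≈-Reasoning P.setoid
  charPoly-partitionedTensor-upperTriangular (suc a) (suc b) S T S-upper T-upper σ σ-admissible = begin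
    charPoly (partitionedTensor S T)
      ≈⟨ charPoly-peel a b S T S-upper T-upper ⟩
    charPoly (scaledH (S zero zero) (T zero zero)) *P charPoly (partitionedTensor (dropFirst S) (dropFirst T))
      ≈⟨ P.*-cong (charPoly-scaledH (S zero zero) (T zero zero) (σ zero) (σ-admissible zero))
           (charPoly-partitionedTensor-upperTriangular a b (dropFirst S) (dropFirst T)
              (λ i j j<i → S-upper (suc i) (suc j) (ℕ.s≤s j<i)) (λ i j j<i → T-upper (suc i) (suc j) (ℕ.s≤s j<i))
              (σ ∘ suc) (σ-admissible ∘ suc)) ⟩
    charPoly (scaledH (σ zero) (σ zero)) *P (prodP (a ⊓ b) (λ j → charPoly (scaledH (σ (suc j)) (σ (suc j)))) *P excess a b)
      ≈⟨ P.*-assoc (charPoly (scaledH (σ zero) (σ zero))) (prodP (a ⊓ b) (λ j → charPoly (scaledH (σ (suc j)) (σ (suc j))))) (excess a b) ⟨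
    prodP (suc a ⊓ suc b) (λ j → charPoly (scaledH (σ j) (σ j))) *P excess (suc a) (suc b) ∎
    where open ≈-Reasoning P.setoid

  charPoly-partitionedTensor-conjugate : ∀ {u₀ u₁} (Q Q⁻¹ : Mat Carrier u₀ u₀) (R R⁻¹ : Mat Carrier u₁ u₁)
    (S : Mat Carrier u₀ u₁) (T : Mat Carrier u₁ u₀) (G₀₁ : Mat Carrier u₀ u₁) (G₁₀ : Mat Carrier u₁ u₀) →
    (Q⁻¹ ⊛ Q) ≈M Id u₀ → (R⁻¹ ⊛ R) ≈M Id u₁ → G₀₁ ≈M ((Q ⊛ S) ⊛ R⁻¹) → G₁₀ ≈M ((R ⊛ T) ⊛ Q⁻¹) →
    charPoly (partitionedTensor G₀₁ G₁₀) ≈P charPoly (partitionedTensor S T)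
  charPoly-partitionedTensor-conjugate {u₀} {u₁} Q Q⁻¹ R R⁻¹ S T G₀₁ G₁₀ Q⁻¹Q≈I R⁻¹R≈I G₀₁≈ G₁₀≈ =
    P.trans (P.sym (charPoly-conjugate _ W W′ (partitionedTensor G₀₁ G₁₀) WW′≈I)) (charPoly-cong WGW′≈)
    where
    ⊗I : ∀ {m} → Mat Carrier m m → ∀ v → Mat Carrier (m ℕ.* v) (m ℕ.* v)
    ⊗I X v = kron X (Id v)
    W W′ : Mat Carrier (u₀ ℕ.* v₀ ℕ.+ u₁ ℕ.* v₁) (u₀ ℕ.* v₀ ℕ.+ u₁ ℕ.* v₁)
    W  = block (⊗I Q⁻¹ v₀) 0M 0M (⊗I R⁻¹ v₁)
    W′ = block (⊗I Q v₀) 0M 0M (⊗I R v₁)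
    WW′≈I : (W ⊛ W′) ≈M Id (u₀ ℕ.* v₀ ℕ.+ u₁ ℕ.* v₁)
    WW′≈I = blockDiagonal-inverse (⊗I Q⁻¹ v₀) (⊗I Q v₀) (⊗I R⁻¹ v₁) (⊗I R v₁)
              (kron-Id-inverse v₀ Q Q⁻¹ Q⁻¹Q≈I) (kron-Id-inverse v₁ R R⁻¹ R⁻¹R≈I)
    quadrant : ∀ {m n p q} (X : Mat Carrier m m) (G : Mat Carrier m n) (Z : Mat Carrier n n) (H : Mat Carrier p q)
      {Y : Mat Carrier m n} → ((X ⊛ G) ⊛ Z) ≈M Y → ((⊗I X p ⊛ kron G H) ⊛ ⊗I Z q) ≈M kron Y H
    quadrant X G Z H XGZ≈Y i j = trans (kron-sandwich X G Z H i j) (kron-cong {B = H} XGZ≈Y (λ _ _ → refl) i j)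
    diagonal-quadrant : ∀ {m} (X⁻¹ X : Mat Carrier m m) → (X⁻¹ ⊛ X) ≈M Id m → ((X⁻¹ ⊛ Id m) ⊛ X) ≈M Id m
    diagonal-quadrant X⁻¹ X X⁻¹X≈I i j = trans (⊛-cong {B = X} (⊛-identityʳ X⁻¹) (λ _ _ → refl) i j) (X⁻¹X≈I i j)
    off-diagonal-quadrant : ∀ {m n} (X⁻¹ X : Mat Carrier m m) (Y G : Mat Carrier m n) (Z⁻¹ Z : Mat Carrier n n) →
      (X⁻¹ ⊛ X) ≈M Id m → (Z⁻¹ ⊛ Z) ≈M Id n → G ≈M ((X ⊛ Y) ⊛ Z⁻¹) → ((X⁻¹ ⊛ G) ⊛ Z) ≈M Y
    off-diagonal-quadrant X⁻¹ X Y G Z⁻¹ Z X⁻¹X≈I Z⁻¹Z≈I G≈ i j =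
      trans (⊛-cong {B = Z} (⊛-cong {A = X⁻¹} (λ _ _ → refl) G≈) (λ _ _ → refl) i j)
            (⊛-cancel-conjugate X⁻¹ X Y Z⁻¹ Z X⁻¹X≈I Z⁻¹Z≈I i j)
    WGW′≈ : ((W ⊛ partitionedTensor G₀₁ G₁₀) ⊛ W′) ≈M partitionedTensor S T
    WGW′≈ i j = trans
      (blockDiagonal-conjugate (⊗I Q⁻¹ v₀) (⊗I R⁻¹ v₁) (kron (Id u₀) H₀₀) (kron G₀₁ H₀₁) (kron G₁₀ H₁₀) (kron (Id u₁) H₁₁)
                               (⊗I Q v₀) (⊗I R v₁) i j)
      (block-cong
        (quadrant Q⁻¹ (Id u₀) Q H₀₀ (diagonal-quadrant Q⁻¹ Q Q⁻¹Q≈I))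
        (quadrant Q⁻¹ G₀₁ R H₀₁ (off-diagonal-quadrant Q⁻¹ Q S G₀₁ R⁻¹ R Q⁻¹Q≈I R⁻¹R≈I G₀₁≈))
        (quadrant R⁻¹ G₁₀ Q H₁₀ (off-diagonal-quadrant R⁻¹ R T G₁₀ Q⁻¹ Q R⁻¹R≈I Q⁻¹Q≈I G₁₀≈))
        (quadrant R⁻¹ (Id u₁) R H₁₁ (diagonal-quadrant R⁻¹ R R⁻¹R≈I)) i j)

theorem2 : ∀ {c ℓ} (K : CommutativeRing c ℓ) → let open Over K in
    IsFieldCR →
    (u₀ u₁ v₀ v₁ : ℕ) →
    (G₀₀ : Mat ℕ u₀ u₀) (G₀₁ : Mat ℕ u₀ u₁) (G₁₀ : Mat ℕ u₁ u₀) (G₁₁ : Mat ℕ u₁ u₁) →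
    (H₀₀ : Mat ℕ v₀ v₀) (H₀₁ : Mat ℕ v₀ v₁) (H₁₀ : Mat ℕ v₁ v₀) (H₁₁ : Mat ℕ v₁ v₁) →
    (Q Q⁻¹ : Mat Carrier u₀ u₀) (R R⁻¹ : Mat Carrier u₁ u₁) →
    (S : Mat Carrier u₀ u₁) (T : Mat Carrier u₁ u₀) →
    (Q ⊛ Q⁻¹) ≈M Id u₀ → (Q⁻¹ ⊛ Q) ≈M Id u₀ →
    (R ⊛ R⁻¹) ≈M Id u₁ → (R⁻¹ ⊛ R) ≈M Id u₁ →
    toR G₀₁ ≈M ((Q ⊛ S) ⊛ R⁻¹) →
    toR G₁₀ ≈M ((R ⊛ T) ⊛ Q⁻¹) →
    UpperTri S → UpperTri T →
    (∀ j → (diagEntry S j ≈ diagEntry′ T j) ⊎ ((diagEntry S j * diagEntry′ T j) ≈ 0#)) →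
    (σ : Fin (u₀ ⊓ u₁) → Carrier) →
    (∀ j → ((σ j ≈ diagEntry S j) × (σ j ≈ diagEntry′ T j))
         ⊎ ((σ j ≈ 0#) × ((diagEntry S j * diagEntry′ T j) ≈ 0#))) →
    (u₁ ≤ u₀ → charPoly (ptp G₀₁ G₁₀ H₀₀ H₀₁ H₁₀ H₁₁)
                 ≈P (prodP (u₀ ⊓ u₁) (λ j → charPoly ((H₀₀ , H₀₁ , H₁₀ , H₁₁) ↑ σ j))
                      *P (charPoly (toR H₀₀) ^P (u₀ ∸ u₁))))
    × (u₀ ≤ u₁ → charPoly (ptp G₀₁ G₁₀ H₀₀ H₀₁ H₁₀ H₁₁)
                 ≈P (prodP (u₀ ⊓ u₁) (λ j → charPoly ((H₀₀ , H₀₁ , H₁₀ , H₁₁) ↑ σ j))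
                      *P (charPoly (toR H₁₁) ^P (u₁ ∸ u₀))))
theorem2 K _ u₀ u₁ v₀ v₁ _ G₀₁ G₁₀ _ H₀₀ H₀₁ H₁₀ H₁₁ Q Q⁻¹ R R⁻¹ S T _ Q⁻¹Q≈I _ R⁻¹R≈I G₀₁≈ G₁₀≈
         S-upper T-upper _ σ σ-admissible =
  (λ u₁≤u₀ → P.trans reduced (P.*-congˡ {product} (excess-≥ u₁≤u₀)))
  , (λ u₀≤u₁ → P.trans reduced (P.*-congˡ {product} (excess-≤ u₀≤u₁)))
  where
  open Over K
  open Polynomial K using (polyCommutativeRing)
  module P = CommutativeRing polyCommutativeRing
  open PartitionedTensorProduct K (toR H₀₀) (toR H₀₁) (toR H₁₀) (toR H₁₁)
  product : Poly
  product = prodP (u₀ ⊓ u₁) (λ j → charPoly ((H₀₀ , H₀₁ , H₁₀ , H₁₁) ↑ σ j))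
  reduced : charPoly (ptp G₀₁ G₁₀ H₀₀ H₀₁ H₁₀ H₁₁) ≈P (product *P excess u₀ u₁)
  reduced = P.trans
    (charPoly-partitionedTensor-conjugate Q Q⁻¹ R R⁻¹ S T (toR G₀₁) (toR G₁₀) Q⁻¹Q≈I R⁻¹R≈I G₀₁≈ G₁₀≈)
    (charPoly-partitionedTensor-upperTriangular u₀ u₁ S T S-upper T-upper σ σ-admissible)
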